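{- Let $p \geq 3$ be a prime number. Then for every integer $m\geq 0$, \begin{align*} \nu_p(P_{2m}(p)) &= \nu_p\Big(\binom{2m}{m}\Big), \\ \nu_p(P_{2m+1}(p)) &= 1 + \nu_p(2m+1) + \nu_p\Big(\binom{2m}{m}\Big). \end{align*} Moreover, for every integer $n\geq0$, $$ \nu_p(P_n(p)) = \frac{2s_p(\lfloor n/2\rfloor) - s_p(n) + (n\bmod 2)\,p}{p-1}. $$
   Context: $P_n(x)$ denotes the $n$-th Legendre polynomial, $P_n(x) = \sum_{k=0}^{n} \binom{n}{k}\binom{n+k}{k}\left(\frac{x-1}{2}\right)^k$. For a nonzero rational $r$, $\nu_p(r)$ is its $p$-adic valuation (exponent of $p$ in $r$). $s_p(n)$ denotes the sum of the base-$p$ digits of the nonnegative integer $n$. -}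

module Defs where

open import Data.Nat using (ℕ; zero; suc; _+_; _*_; _∸_; _^_; _/_; _%_)
open import Data.Nat.Divisibility using (_∣?_)
open import Data.Nat.Combinatorics using (_C_)
open import Relation.Nullary using (yes; no)

sumTo : ℕ → (ℕ → ℕ) → ℕ
sumTo zero    f = f 0
sumTo (suc n) f = sumTo n f + f (suc n)

-- Value of the Legendre polynomial P_n at an ODD integer x ≥ 1:
--   P_n(x) = Σ_{k=0}^{n} C(n,k) C(n+k,k) ((x-1)/2)^k ,
-- where (x-1)/2 is an exact natural number since x is odd.
legendreAtOdd : ℕ → ℕ → ℕ
legendreAtOdd n x = sumTo n (λ k → (n C k) * ((n + k) C k) * (((x ∸ 1) / 2) ^ k))

-- p-adic valuation of a natural number (ν p 0 = 0 by convention, never used).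
-- The fuel argument n is enough for every p ≥ 2.
valFuel : ℕ → (p : ℕ) → ℕ → ℕ
valFuel zero    _       _ = 0
valFuel (suc f) zero    _ = 0
valFuel (suc f) (suc q) zero = 0
valFuel (suc f) (suc q) (suc m) with suc q ∣? suc m
... | yes _ = suc (valFuel f (suc q) (suc m / suc q))
... | no  _ = 0

ν : ℕ → ℕ → ℕ
ν p n = valFuel n p n

-- sum of base-p digits (fuel n suffices for p ≥ 2)
digitFuel : ℕ → (p : ℕ) → ℕ → ℕ
digitFuel zero    _       _ = 0
digitFuel (suc f) zero    _ = 0
digitFuel (suc f) (suc q) n = n % suc q + digitFuel f (suc q) (n / suc q)

s : ℕ → ℕ → ℕ
s p n = digitFuel n p n

module Submission where

-- Over ℤ, 2ⁿ Pₙ(x) = Σⱼ (−1)ʲ C(n,j) C(2n−2j,n) xⁿ⁻²ʲ: both sides satisfy Bonnet's recurrence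
-- (n+2) Pₙ₊₂ = (2n+3) x Pₙ₊₁ − (n+1) Pₙ and agree for n = 0, 1. At x = p the terms tⱼ of the sum
-- satisfy tⱼ (n−2j)(n−2j−1) = p² · 2(j+1)(2n−2j−1) · tⱼ₊₁, so for K = ⌊n/2⌋ telescoping gives
-- p^(2(K−j)) t_K ∣ tⱼ (n−2j)!. By Legendre's formula (p−1) ν((n−2j)!) = (n−2j) − s_p(n−2j), hence
-- ν((n−2j)!) ≤ K−j when p ≥ 3, and every tⱼ with j < K is divisible by p^(ν(t_K)+1). Therefore
-- ν(Pₙ(p)) = ν(t_K), which is ν(C(2m,m)) for n = 2m and ν(2(2m+1) C(2m,m) p) for n = 2m+1.
-- Writing these through factorials and applying Legendre's formula again gives the digit-sum formula.

module IntegerSums where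

  open import Data.Nat as ℕ using (ℕ; zero; suc; _<_; _≤_; z≤n; s≤s)
  open import Data.Nat.Properties using (m≤n+m; ≤-refl; m≤n⇒m≤1+n)
  open import Data.Integer using (ℤ; +_; 0ℤ; _+_; _*_)
  open import Data.Integer.Properties using (+-identityˡ; +-identityʳ; *-distribˡ-+)
  open import Data.Integer.Divisibility.Signed using (_∣_; ∣-trans; ∣m∣n⇒∣m+n; ∣m+n∣m⇒∣n)
  open import Data.Integer.Tactic.RingSolver using (solve-∀)
  open import Data.Product using (_×_; _,_)
  open import Relation.Nullary using (¬_)
  open import Relation.Binary.PropositionalEquality
  open import Defs using (sumTo)

  sumToℤ : ℕ → (ℕ → ℤ) → ℤ
  sumToℤ zero    f = f 0
  sumToℤ (suc n) f = sumToℤ n f + f (suc n)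

  pos-sumTo : ∀ n f → + sumTo n f ≡ sumToℤ n (λ k → + f k)
  pos-sumTo zero    f = refl
  pos-sumTo (suc n) f = cong (_+ + f (suc n)) (pos-sumTo n f)

  sumToℤ-cong : ∀ n {f g : ℕ → ℤ} → (∀ k → f k ≡ g k) → sumToℤ n f ≡ sumToℤ n g
  sumToℤ-cong zero    f≡g = f≡g 0
  sumToℤ-cong (suc n) f≡g = cong₂ _+_ (sumToℤ-cong n f≡g) (f≡g (suc n))

  sumToℤ-+ : ∀ n (f g : ℕ → ℤ) → sumToℤ n (λ k → f k + g k) ≡ sumToℤ n f + sumToℤ n g
  sumToℤ-+ zero    f g = refl
  sumToℤ-+ (suc n) f g = trans (cong (_+ (f (suc n) + g (suc n))) (sumToℤ-+ n f g))
                               (interchange (sumToℤ n f) (sumToℤ n g) (f (suc n)) (g (suc n)))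
    where interchange : ∀ a b c d → a + b + (c + d) ≡ a + c + (b + d)
          interchange = solve-∀

  sumToℤ-* : ∀ n a (f : ℕ → ℤ) → sumToℤ n (λ k → a * f k) ≡ a * sumToℤ n f
  sumToℤ-* zero    a f = refl
  sumToℤ-* (suc n) a f = trans (cong (_+ a * f (suc n)) (sumToℤ-* n a f))
                               (sym (*-distribˡ-+ a (sumToℤ n f) (f (suc n))))

  sumToℤ-linear : ∀ n a b (f g : ℕ → ℤ) →
    sumToℤ n (λ k → a * f k + b * g k) ≡ a * sumToℤ n f + b * sumToℤ n g
  sumToℤ-linear n a b f g =
    trans (sumToℤ-+ n (λ k → a * f k) (λ k → b * g k)) (cong₂ _+_ (sumToℤ-* n a f) (sumToℤ-* n b g))

  sumToℤ-extend : ∀ n d (f : ℕ → ℤ) → (∀ k → n < k → f k ≡ 0ℤ) → sumToℤ (d ℕ.+ n) f ≡ sumToℤ n f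
  sumToℤ-extend n zero    f vanish = refl
  sumToℤ-extend n (suc d) f vanish = begin
    sumToℤ (d ℕ.+ n) f + f (suc (d ℕ.+ n)) ≡⟨ cong₂ _+_ (sumToℤ-extend n d f vanish) (vanish _ (s≤s (m≤n+m n d))) ⟩
    sumToℤ n f + 0ℤ                        ≡⟨ +-identityʳ (sumToℤ n f) ⟩
    sumToℤ n f                             ∎
    where open ≡-Reasoning

  delay : (ℕ → ℤ) → ℕ → ℤ
  delay f zero    = 0ℤ
  delay f (suc k) = f k

  sumToℤ-delay : ∀ n f → sumToℤ (suc n) (delay f) ≡ sumToℤ n f
  sumToℤ-delay zero    f = +-identityˡ (f 0)
  sumToℤ-delay (suc n) f = cong (_+ f (suc n)) (sumToℤ-delay n f)

  sumToℤ-∣ : ∀ {d} n (f : ℕ → ℤ) → (∀ j → j ≤ n → d ∣ f j) → d ∣ sumToℤ n f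
  sumToℤ-∣ zero    f d∣f = d∣f 0 z≤n
  sumToℤ-∣ (suc n) f d∣f = ∣m∣n⇒∣m+n (sumToℤ-∣ n f (λ j j≤n → d∣f j (m≤n⇒m≤1+n j≤n))) (d∣f (suc n) ≤-refl)

  sumToℤ-exactly-∣ : ∀ {d d′} K (f : ℕ → ℤ) → d ∣ d′ → (∀ j → j < K → d′ ∣ f j) →
    d ∣ f K → ¬ d′ ∣ f K → d ∣ sumToℤ K f × ¬ d′ ∣ sumToℤ K f
  sumToℤ-exactly-∣ zero    f d∣d′ _ d∣fK d′∤fK = d∣fK , d′∤fK
  sumToℤ-exactly-∣ (suc K) f d∣d′ d′∣f d∣fK d′∤fK =
    ∣m∣n⇒∣m+n (∣-trans d∣d′ d′∣init) d∣fK , λ d′∣sum → d′∤fK (∣m+n∣m⇒∣n d′∣sum d′∣init)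
    where d′∣init = sumToℤ-∣ K f (λ j j≤K → d′∣f j (s≤s j≤K))

module Binomial where

  open import Data.Nat
  open import Data.Nat.Properties
  open import Data.Nat.Combinatorics
    using (_C_; nCk≡n!/k![n-k]!; k![n∸k]!∣n!; k>n⇒nCk≡0)
  open import Data.Nat.DivMod using (m/n*n≡m)
  open import Data.Nat.Tactic.RingSolver using (solve-∀)
  open import Data.Product using (_,_)
  open import Relation.Nullary using (yes; no)
  open import Relation.Binary.PropositionalEquality

  C-factorial : ∀ k d → ((k + d) C k) * (k ! * d !) ≡ (k + d) !
  C-factorial k d = begin
    ((k + d) C k) * (k ! * d !) ≡⟨ cong (λ e → ((k + d) C k) * (k ! * e !)) (m+n∸m≡n k d) ⟨
    ((k + d) C k) * F           ≡⟨ cong (_* F) (nCk≡n!/k![n-k]! k≤k+d) ⟩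
    (k + d) ! / F * F           ≡⟨ m/n*n≡m (k![n∸k]!∣n! k≤k+d) ⟩
    (k + d) !                   ∎
    where
    open ≡-Reasoning
    k≤k+d = m≤m+n k d
    F = k ! * (k + d ∸ k) !
    instance _ = k !* (k + d ∸ k) !≢0

  C-absorb : ∀ n k → suc k * (suc n C suc k) ≡ suc n * (n C k)
  C-absorb n k with k ≤? n
  ... | no k≰n = begin
    suc k * (suc n C suc k) ≡⟨ cong (suc k *_) (k>n⇒nCk≡0 (s≤s k>n)) ⟩
    suc k * 0               ≡⟨ *-zeroʳ (suc k) ⟩
    0                       ≡⟨ *-zeroʳ (suc n) ⟨
    suc n * 0               ≡⟨ cong (suc n *_) (k>n⇒nCk≡0 k>n) ⟨
    suc n * (n C k)         ∎
    where
    open ≡-Reasoning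
    k>n = ≰⇒> k≰n
  ... | yes k≤n with m≤n⇒∃[o]m+o≡n k≤n
  ... | d , refl = *-cancelʳ-≡ _ _ (k ! * d !) (begin
    suc k * X * (k ! * d !)                     ≡⟨ reorder (suc k) X (k !) (d !) ⟩
    X * (suc k ! * d !)                         ≡⟨ C-factorial (suc k) d ⟩
    suc (k + d) * (k + d) !                     ≡⟨ cong (suc (k + d) *_) (C-factorial k d) ⟨
    suc (k + d) * (((k + d) C k) * (k ! * d !)) ≡⟨ *-assoc (suc (k + d)) ((k + d) C k) (k ! * d !) ⟨
    suc (k + d) * ((k + d) C k) * (k ! * d !)   ∎)
    where
    open ≡-Reasoning
    X = suc (k + d) C suc k
    instance _ = k !* d !≢0
    reorder : ∀ a x u v → a * x * (u * v) ≡ x * (a * u * v)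
    reorder = solve-∀

  C-pos : ∀ {n k} → k ≤ n → 0 < n C k
  C-pos {n} {k} k≤n with m≤n⇒∃[o]m+o≡n k≤n
  ... | d , refl = >-nonZero⁻¹ _ {{m*n≢0⇒m≢0 _ {{subst NonZero (sym (C-factorial k d)) ((k + d) !≢0)}}}}

module BinomialRelations where

  open import Data.Nat as ℕ using (ℕ; zero; suc)
  open import Data.Nat.Combinatorics using (_C_; nCk+nC[k+1]≡[n+1]C[k+1]; nCn≡1)
  open import Data.Integer using (ℤ; +_; 1ℤ; _+_; _-_; _*_)
  open import Data.Integer.Properties using (pos-*; *-cancelˡ-≡; +-identityʳ; *-identityʳ; *-assoc)
  open import Data.Integer.Tactic.RingSolver using (solve-∀)
  open import Relation.Binary.PropositionalEquality
  open Binomial using (C-absorb)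

  -- With genuine subtraction the relations below hold for all n and k, including k > n where
  -- both sides vanish, so the coefficient recurrences built from them need no case analysis.
  binom : ℕ → ℕ → ℤ
  binom n k = + (n C k)

  private
    swap : ∀ a b x → a * (b * x) ≡ b * (a * x)
    swap = solve-∀
    swap₃ : ∀ a b x → a * b * x ≡ b * (a * x)
    swap₃ = solve-∀

  binom-pascal : ∀ n k → binom (suc n) (suc k) ≡ binom n k + binom n (suc k)
  binom-pascal n k = cong +_ (sym (nCk+nC[k+1]≡[n+1]C[k+1] n k))

  binom-absorb : ∀ n k → + suc k * binom (suc n) (suc k) ≡ + suc n * binom n k
  binom-absorb n k = begin
    + suc k * binom (suc n) (suc k) ≡⟨ pos-* (suc k) (suc n C suc k) ⟨
    + (suc k ℕ.* (suc n C suc k))   ≡⟨ cong +_ (C-absorb n k) ⟩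
    + (suc n ℕ.* (n C k))           ≡⟨ pos-* (suc n) (n C k) ⟩
    + suc n * binom n k             ∎
    where open ≡-Reasoning

  binom-drop : ∀ n k → + suc k * binom n (suc k) ≡ (+ n - + k) * binom n k
  binom-drop n k = begin
    + suc k * Y                                   ≡⟨ split (+ k) X Y ⟩
    + suc k * (X + Y) - + suc k * X               ≡⟨ cong (λ z → + suc k * z - + suc k * X) (binom-pascal n k) ⟨
    + suc k * binom (suc n) (suc k) - + suc k * X ≡⟨ cong (_- + suc k * X) (binom-absorb n k) ⟩
    + suc n * X - + suc k * X                     ≡⟨ collect (+ n) (+ k) X ⟩
    (+ n - + k) * X                               ∎
    where
    open ≡-Reasoning
    X = binom n k
    Y = binom n (suc k)
    split : ∀ k X Y → (1ℤ + k) * Y ≡ (1ℤ + k) * (X + Y) - (1ℤ + k) * X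
    split = solve-∀
    collect : ∀ n k X → (1ℤ + n) * X - (1ℤ + k) * X ≡ (n - k) * X
    collect = solve-∀

  binom-shift : ∀ n k → (+ suc n - + k) * binom (suc n) k ≡ + suc n * binom n k
  binom-shift n zero = cong (_* 1ℤ) (+-identityʳ (+ suc n))
  binom-shift n (suc k) = *-cancelˡ-≡ (+ suc k) _ _ (begin
    + suc k * ((+ suc n - + suc k) * binom (suc n) (suc k)) ≡⟨ cancel-suc (+ n) (+ k) (binom (suc n) (suc k)) ⟩
    (+ n - + k) * (+ suc k * binom (suc n) (suc k))         ≡⟨ cong ((+ n - + k) *_) (binom-absorb n k) ⟩
    (+ n - + k) * (+ suc n * binom n k)                     ≡⟨ swap (+ n - + k) (+ suc n) (binom n k) ⟩
    + suc n * ((+ n - + k) * binom n k)                     ≡⟨ cong (+ suc n *_) (binom-drop n k) ⟨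
    + suc n * (+ suc k * binom n (suc k))                   ≡⟨ swap (+ suc n) (+ suc k) (binom n (suc k)) ⟩
    + suc k * (+ suc n * binom n (suc k))                   ∎)
    where
    open ≡-Reasoning
    cancel-suc : ∀ n k X → (1ℤ + k) * (((1ℤ + n) - (1ℤ + k)) * X) ≡ (n - k) * ((1ℤ + k) * X)
    cancel-suc = solve-∀

  binom-suc-self : ∀ n → binom (suc n) n ≡ + suc n
  binom-suc-self n = begin
    binom (suc n) n                   ≡⟨ unit (+ n) (binom (suc n) n) ⟩
    (+ suc n - + n) * binom (suc n) n ≡⟨ binom-shift n n ⟩
    + suc n * binom n n               ≡⟨ cong (λ c → + suc n * + c) (nCn≡1 n) ⟩
    + suc n * 1ℤ                      ≡⟨ *-identityʳ (+ suc n) ⟩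
    + suc n                           ∎
    where
    open ≡-Reasoning
    unit : ∀ n x → x ≡ (1ℤ + n - n) * x
    unit = solve-∀

  binom-absorb² : ∀ n k →
    + suc (suc k) * + suc k * binom (suc (suc n)) (suc (suc k)) ≡ + suc (suc n) * + suc n * binom n k
  binom-absorb² n k = begin
    + suc (suc k) * + suc k * binom (suc (suc n)) (suc (suc k))   ≡⟨ swap₃ (+ suc (suc k)) (+ suc k) _ ⟩
    + suc k * (+ suc (suc k) * binom (suc (suc n)) (suc (suc k))) ≡⟨ cong (+ suc k *_) (binom-absorb (suc n) (suc k)) ⟩
    + suc k * (+ suc (suc n) * binom (suc n) (suc k))             ≡⟨ swap (+ suc k) (+ suc (suc n)) _ ⟩
    + suc (suc n) * (+ suc k * binom (suc n) (suc k))             ≡⟨ cong (+ suc (suc n) *_) (binom-absorb n k) ⟩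
    + suc (suc n) * (+ suc n * binom n k)                         ≡⟨ *-assoc (+ suc (suc n)) (+ suc n) _ ⟨
    + suc (suc n) * + suc n * binom n k                           ∎
    where open ≡-Reasoning

  binom-absorb-shift : ∀ n k →
    (+ suc n - + k) * + suc k * binom (suc (suc n)) (suc k) ≡ + suc (suc n) * + suc n * binom n k
  binom-absorb-shift n k = begin
    (+ suc n - + k) * + suc k * binom (suc (suc n)) (suc k)   ≡⟨ *-assoc (+ suc n - + k) (+ suc k) _ ⟩
    (+ suc n - + k) * (+ suc k * binom (suc (suc n)) (suc k)) ≡⟨ cong ((+ suc n - + k) *_) (binom-absorb (suc n) k) ⟩
    (+ suc n - + k) * (+ suc (suc n) * binom (suc n) k)       ≡⟨ swap (+ suc n - + k) (+ suc (suc n)) _ ⟩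
    + suc (suc n) * ((+ suc n - + k) * binom (suc n) k)       ≡⟨ cong (+ suc (suc n) *_) (binom-shift n k) ⟩
    + suc (suc n) * (+ suc n * binom n k)                     ≡⟨ *-assoc (+ suc (suc n)) (+ suc n) _ ⟨
    + suc (suc n) * + suc n * binom n k                       ∎
    where open ≡-Reasoning

  binom-shift² : ∀ n k →
    (+ suc (suc n) - + k) * (+ suc n - + k) * binom (suc (suc n)) k ≡ + suc (suc n) * + suc n * binom n k
  binom-shift² n k = begin
    (+ suc (suc n) - + k) * (+ suc n - + k) * binom (suc (suc n)) k   ≡⟨ swap₃ (+ suc (suc n) - + k) (+ suc n - + k) _ ⟩
    (+ suc n - + k) * ((+ suc (suc n) - + k) * binom (suc (suc n)) k) ≡⟨ cong ((+ suc n - + k) *_) (binom-shift (suc n) k) ⟩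
    (+ suc n - + k) * (+ suc (suc n) * binom (suc n) k)               ≡⟨ swap (+ suc n - + k) (+ suc (suc n)) _ ⟩
    + suc (suc n) * ((+ suc n - + k) * binom (suc n) k)               ≡⟨ cong (+ suc (suc n) *_) (binom-shift n k) ⟩
    + suc (suc n) * (+ suc n * binom n k)                             ≡⟨ *-assoc (+ suc (suc n)) (+ suc n) _ ⟨
    + suc (suc n) * + suc n * binom n k                               ∎
    where open ≡-Reasoning

module LegendreCoefficients where

  open import Data.Nat as ℕ using (ℕ; suc)
  open import Data.Nat.Properties using (+-suc)
  open import Data.Nat.Combinatorics using (_C_)
  open import Data.Integer using (+_; 1ℤ; _+_; _-_; _*_)
  open import Data.Integer.Properties using (pos-*; *-cancelˡ-≡)
  open import Data.Integer.Tactic.RingSolver using (solve-∀)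
  open import Relation.Binary.PropositionalEquality
  open BinomialRelations

  legendreCoeff : ℕ → ℕ → ℕ
  legendreCoeff n k = (n C k) ℕ.* ((n ℕ.+ k) C k)

  private
    legendreCoeff-binom : ∀ n k → + legendreCoeff n k ≡ binom n k * binom (n ℕ.+ k) k
    legendreCoeff-binom n k = pos-* (n C k) ((n ℕ.+ k) C k)

  legendreCoeff-raise : ∀ n k →
    + suc k * + suc k * + legendreCoeff n (suc k) ≡ (+ n - + k) * (+ n + + suc k) * + legendreCoeff n k
  legendreCoeff-raise n k = begin
    + suc k * + suc k * + legendreCoeff n (suc k)
      ≡⟨ cong (+ suc k * + suc k *_) (trans (legendreCoeff-binom n (suc k)) (cong (λ i → binom n (suc k) * binom i (suc k)) (+-suc n k))) ⟩
    + suc k * + suc k * (binom n (suc k) * binom (suc (n ℕ.+ k)) (suc k))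
      ≡⟨ interchange (+ suc k) (binom n (suc k)) (binom (suc (n ℕ.+ k)) (suc k)) ⟩
    (+ suc k * binom n (suc k)) * (+ suc k * binom (suc (n ℕ.+ k)) (suc k))
      ≡⟨ cong₂ _*_ (binom-drop n k) (binom-absorb (n ℕ.+ k) k) ⟩
    ((+ n - + k) * binom n k) * (+ suc (n ℕ.+ k) * binom (n ℕ.+ k) k)
      ≡⟨ interchange′ (+ n - + k) (+ suc (n ℕ.+ k)) (binom n k) (binom (n ℕ.+ k) k) ⟩
    (+ n - + k) * + suc (n ℕ.+ k) * (binom n k * binom (n ℕ.+ k) k)
      ≡⟨ cong₂ (λ i x → (+ n - + k) * + i * x) (+-suc n k) (legendreCoeff-binom n k) ⟨
    (+ n - + k) * (+ n + + suc k) * + legendreCoeff n k ∎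
    where
    open ≡-Reasoning
    interchange : ∀ s x y → s * s * (x * y) ≡ (s * x) * (s * y)
    interchange = solve-∀
    interchange′ : ∀ a b x y → (a * x) * (b * y) ≡ a * b * (x * y)
    interchange′ = solve-∀

  legendreCoeff-lower : ∀ n k →
    (+ suc n - + k) * + legendreCoeff (suc n) k ≡ (+ suc n + + k) * + legendreCoeff n k
  legendreCoeff-lower n k = *-cancelˡ-≡ (+ suc n) _ _ (begin
    + suc n * ((+ suc n - + k) * + legendreCoeff (suc n) k)
      ≡⟨ cong (λ x → + suc n * ((+ suc n - + k) * x)) (legendreCoeff-binom (suc n) k) ⟩
    + suc n * ((+ suc n - + k) * (binom (suc n) k * binom (suc (n ℕ.+ k)) k))
      ≡⟨ regroup (+ n) (+ k) (binom (suc n) k) (binom (suc (n ℕ.+ k)) k) ⟩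
    ((+ suc n - + k) * binom (suc n) k) * ((+ suc (n ℕ.+ k) - + k) * binom (suc (n ℕ.+ k)) k)
      ≡⟨ cong₂ _*_ (binom-shift n k) (binom-shift (n ℕ.+ k) k) ⟩
    (+ suc n * binom n k) * (+ suc (n ℕ.+ k) * binom (n ℕ.+ k) k)
      ≡⟨ regroup′ (+ n) (+ k) (binom n k) (binom (n ℕ.+ k) k) ⟩
    + suc n * ((+ suc n + + k) * (binom n k * binom (n ℕ.+ k) k))
      ≡⟨ cong (λ x → + suc n * ((+ suc n + + k) * x)) (legendreCoeff-binom n k) ⟨
    + suc n * ((+ suc n + + k) * + legendreCoeff n k) ∎)
    where
    open ≡-Reasoning
    regroup : ∀ n k x y → (1ℤ + n) * ((1ℤ + n - k) * (x * y)) ≡ ((1ℤ + n - k) * x) * ((1ℤ + (n + k) - k) * y)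
    regroup = solve-∀
    regroup′ : ∀ n k x y → ((1ℤ + n) * x) * ((1ℤ + (n + k)) * y) ≡ (1ℤ + n) * ((1ℤ + n + k) * (x * y))
    regroup′ = solve-∀

  -- Multiplied by (k+1)², every term is a polynomial multiple of legendreCoeff (m+1) k by
  -- raise and lower, and the recurrence becomes a polynomial identity in m and k.
  legendreCoeff-rec : ∀ m k →
    + suc (suc m) * + legendreCoeff (suc (suc m)) (suc k) + + suc m * + legendreCoeff m (suc k)
    ≡ (+ 2 * + m + + 3) * (+ legendreCoeff (suc m) (suc k) + + 2 * + legendreCoeff (suc m) k)
  legendreCoeff-rec m k = *-cancelˡ-≡ (+ suc k * + suc k) _ _ (begin
    s * (+ suc (suc m) * A₂′ + + suc m * A₀′)
      ≡⟨ distrib s (+ suc (suc m)) (+ suc m) A₂′ A₀′ ⟩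
    + suc (suc m) * (s * A₂′) + + suc m * (s * A₀′)
      ≡⟨ cong₂ (λ x y → + suc (suc m) * x + + suc m * y) (legendreCoeff-raise (suc (suc m)) k) (legendreCoeff-raise m k) ⟩
    + suc (suc m) * ((+ suc (suc m) - + k) * (+ suc (suc m) + + suc k) * A₂) + + suc m * ((+ m - + k) * (+ m + + suc k) * A₀)
      ≡⟨ regroup (+ m) (+ k) A₂ A₀ ⟩
    + suc (suc m) * (+ m + + k + + 3) * ((+ suc (suc m) - + k) * A₂) + + suc m * (+ m - + k) * ((+ suc m + + k) * A₀)
      ≡⟨ cong₂ (λ x y → + suc (suc m) * (+ m + + k + + 3) * x + + suc m * (+ m - + k) * y) (legendreCoeff-lower (suc m) k) (sym (legendreCoeff-lower m k)) ⟩
    + suc (suc m) * (+ m + + k + + 3) * ((+ suc (suc m) + + k) * A₁) + + suc m * (+ m - + k) * ((+ suc m - + k) * A₁)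
      ≡⟨ polynomial (+ m) (+ k) A₁ ⟩
    (+ 2 * + m + + 3) * ((+ suc m - + k) * (+ suc m + + suc k) * A₁ + + 2 * (s * A₁))
      ≡⟨ cong (λ x → (+ 2 * + m + + 3) * (x + + 2 * (s * A₁))) (legendreCoeff-raise (suc m) k) ⟨
    (+ 2 * + m + + 3) * (s * A₁′ + + 2 * (s * A₁))
      ≡⟨ factor s (+ 2 * + m + + 3) A₁′ A₁ ⟩
    s * ((+ 2 * + m + + 3) * (A₁′ + + 2 * A₁)) ∎)
    where
    open ≡-Reasoning
    s = + suc k * + suc k
    A₀ = + legendreCoeff m k
    A₁ = + legendreCoeff (suc m) k
    A₂ = + legendreCoeff (suc (suc m)) k
    A₀′ = + legendreCoeff m (suc k)
    A₁′ = + legendreCoeff (suc m) (suc k)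
    A₂′ = + legendreCoeff (suc (suc m)) (suc k)
    distrib : ∀ s a b x y → s * (a * x + b * y) ≡ a * (s * x) + b * (s * y)
    distrib = solve-∀
    regroup : ∀ m k x y →
      (1ℤ + (1ℤ + m)) * ((1ℤ + (1ℤ + m) - k) * (1ℤ + (1ℤ + m) + (1ℤ + k)) * x) + (1ℤ + m) * ((m - k) * (m + (1ℤ + k)) * y)
      ≡ (1ℤ + (1ℤ + m)) * (m + k + + 3) * ((1ℤ + (1ℤ + m) - k) * x) + (1ℤ + m) * (m - k) * ((1ℤ + m + k) * y)
    regroup = solve-∀
    polynomial : ∀ m k y →
      (1ℤ + (1ℤ + m)) * (m + k + + 3) * ((1ℤ + (1ℤ + m) + k) * y) + (1ℤ + m) * (m - k) * ((1ℤ + m - k) * y)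
      ≡ (+ 2 * m + + 3) * ((1ℤ + m - k) * (1ℤ + m + (1ℤ + k)) * y + + 2 * ((1ℤ + k) * (1ℤ + k) * y))
    polynomial = solve-∀
    factor : ∀ s c x y → c * (s * x + + 2 * (s * y)) ≡ s * (c * (x + + 2 * y))
    factor = solve-∀

module RodriguesCoefficients where

  open import Data.Nat as ℕ using (ℕ; suc; _∸_; _<_; _≤_; s≤s; _≤?_; >-nonZero; >-nonZero⁻¹)
  open import Data.Nat.Properties as ℕₚ
    using ( +-suc; m+n∸m≡n; m≤n⇒∃[o]m+o≡n; ≰⇒>; m*n≢0; *-identityʳ; *-zeroʳ; +-monoˡ-<; +-cancelˡ-<
          ; +-monoˡ-≤; +-cancelˡ-≤; ≤-trans; <-≤-trans; m≤m+n; m≤n+m)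
  open import Data.Nat.Combinatorics using (_C_; k>n⇒nCk≡0; nCn≡1)
  open import Data.Integer using (+_; 0ℤ; 1ℤ; _+_; _-_; _*_)
  open import Data.Integer.Properties using (pos-*; *-cancelˡ-≡; *-identityˡ; +-injective)
  open import Data.Integer.Tactic.RingSolver using (solve-∀)
  open import Data.Product using (_,_)
  open import Relation.Nullary using (yes; no)
  open import Relation.Binary.PropositionalEquality
  open Binomial using (C-pos)
  open BinomialRelations

  -- C(n,j) C(2n−2j,n), the coefficient of (−1)ʲ x^(n−2j) in 2ⁿ Pₙ(x)
  rodriguesCoeff : ℕ → ℕ → ℕ
  rodriguesCoeff n j = (n C j) ℕ.* (((n ∸ j) ℕ.+ (n ∸ j)) C n)

  rodriguesCoeff-vanish : ∀ {n j} → n < j ℕ.+ j → rodriguesCoeff n j ≡ 0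
  rodriguesCoeff-vanish {n} {j} n<2j with j ≤? n
  ... | no j≰n = cong (ℕ._* (((n ∸ j) ℕ.+ (n ∸ j)) C n)) (k>n⇒nCk≡0 (≰⇒> j≰n))
  ... | yes j≤n with m≤n⇒∃[o]m+o≡n j≤n
  ... | d , refl = begin
    c ℕ.* ((j ℕ.+ d ∸ j ℕ.+ (j ℕ.+ d ∸ j)) C (j ℕ.+ d)) ≡⟨ cong (λ e → c ℕ.* ((e ℕ.+ e) C (j ℕ.+ d))) (m+n∸m≡n j d) ⟩
    c ℕ.* ((d ℕ.+ d) C (j ℕ.+ d))                       ≡⟨ cong (c ℕ.*_) (k>n⇒nCk≡0 d+d<j+d) ⟩
    c ℕ.* 0                                             ≡⟨ *-zeroʳ c ⟩
    0                                                   ∎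
    where
    open ≡-Reasoning
    c = (j ℕ.+ d) C j
    d+d<j+d = +-monoˡ-< d (+-cancelˡ-< j d j n<2j)

  rodriguesCoeff-pos : ∀ {n j} → j ℕ.+ j ≤ n → 0 < rodriguesCoeff n j
  rodriguesCoeff-pos {n} {j} 2j≤n with m≤n⇒∃[o]m+o≡n (≤-trans (m≤m+n j j) 2j≤n)
  ... | d , refl = subst (λ e → 0 < ((j ℕ.+ d) C j) ℕ.* ((e ℕ.+ e) C (j ℕ.+ d))) (sym (m+n∸m≡n j d))
    (>-nonZero⁻¹ _ {{m*n≢0 _ _ {{>-nonZero (C-pos (m≤m+n j d))}} {{>-nonZero (C-pos j+d≤d+d)}}}})
    where j+d≤d+d = +-monoˡ-≤ d (+-cancelˡ-≤ j j d 2j≤n)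

  private
    rodrigues-binom : ∀ n j {d} → n ∸ j ≡ d → + rodriguesCoeff n j ≡ binom n j * binom (d ℕ.+ d) n
    rodrigues-binom n j refl = pos-* (n C j) (((n ∸ j) ℕ.+ (n ∸ j)) C n)

    suc-∸ : ∀ i N → suc (i ℕ.+ N) ∸ i ≡ suc N
    suc-∸ i N = trans (cong (_∸ i) (sym (+-suc i N))) (m+n∸m≡n i (suc N))

    double-suc : ∀ N → suc N ℕ.+ suc N ≡ suc (suc (N ℕ.+ N))
    double-suc N = cong suc (+-suc N N)

    rodrigues-binom-suc : ∀ n j {d} → n ∸ j ≡ suc d →
      + rodriguesCoeff n j ≡ binom n j * binom (suc (suc (d ℕ.+ d))) n
    rodrigues-binom-suc n j {d} eq =
      trans (rodrigues-binom n j eq) (cong (λ i → binom n j * binom i n) (double-suc d))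

  rodriguesCoeff-rec₀ : ∀ n →
    + suc n * + rodriguesCoeff (suc n) 0 ≡ + 2 * (+ 2 * + n + 1ℤ) * + rodriguesCoeff n 0
  rodriguesCoeff-rec₀ n = *-cancelˡ-≡ (+ suc n) _ _ (begin
    + suc n * (+ suc n * + rodriguesCoeff (suc n) 0)
      ≡⟨ cong (λ x → + suc n * (+ suc n * x)) (rodrigues-binom-suc (suc n) 0 refl) ⟩
    + suc n * (+ suc n * (1ℤ * binom (suc (suc (n ℕ.+ n))) (suc n)))
      ≡⟨ cong (λ x → + suc n * x) (trans (cong (+ suc n *_) (*-identityˡ _)) (binom-absorb (suc (n ℕ.+ n)) n)) ⟩
    + suc n * (+ suc (suc (n ℕ.+ n)) * binom (suc (n ℕ.+ n)) n)
      ≡⟨ regroup (+ n) (binom (suc (n ℕ.+ n)) n) ⟩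
    + suc (suc (n ℕ.+ n)) * ((+ suc (n ℕ.+ n) - + n) * binom (suc (n ℕ.+ n)) n)
      ≡⟨ cong (+ suc (suc (n ℕ.+ n)) *_) (binom-shift (n ℕ.+ n) n) ⟩
    + suc (suc (n ℕ.+ n)) * (+ suc (n ℕ.+ n) * binom (n ℕ.+ n) n)
      ≡⟨ regroup′ (+ n) (binom (n ℕ.+ n) n) ⟩
    + suc n * (+ 2 * (+ 2 * + n + 1ℤ) * (1ℤ * binom (n ℕ.+ n) n))
      ≡⟨ cong (λ x → + suc n * (+ 2 * (+ 2 * + n + 1ℤ) * x)) (rodrigues-binom n 0 refl) ⟨
    + suc n * (+ 2 * (+ 2 * + n + 1ℤ) * + rodriguesCoeff n 0) ∎)
    where
    open ≡-Reasoning
    regroup : ∀ n x → (1ℤ + n) * ((1ℤ + (1ℤ + (n + n))) * x) ≡ (1ℤ + (1ℤ + (n + n))) * ((1ℤ + (n + n) - n) * x)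
    regroup = solve-∀
    regroup′ : ∀ n x → (1ℤ + (1ℤ + (n + n))) * ((1ℤ + (n + n)) * x) ≡ (1ℤ + n) * (+ 2 * (+ 2 * n + 1ℤ) * (1ℤ * x))
    regroup′ = solve-∀

  private
    -- With N = m − i, multiplying by G writes all three coefficients as polynomial multiples of
    -- C(m,i) C(2N,m), leaving a polynomial identity in i and N.
    rodriguesCoeff-rec-≤ : ∀ i N → let m = i ℕ.+ N in
      + suc (suc m) * + rodriguesCoeff (suc (suc m)) (suc i)
      ≡ + 2 * (+ 2 * + m + + 3) * + rodriguesCoeff (suc m) (suc i) + + 4 * + suc m * + rodriguesCoeff m i
    rodriguesCoeff-rec-≤ i N = *-cancelˡ-≡ G _ _ (begin
      G * (+ suc (suc m) * + rodriguesCoeff (suc (suc m)) (suc i))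
        ≡⟨ cong (λ x → G * (+ suc (suc m) * x)) (rodrigues-binom-suc (suc (suc m)) (suc i) (suc-∸ i N)) ⟩
      G * (+ suc (suc m) * (X₂ * Y₂))
        ≡⟨ regroup₂ (+ i) (+ N) X₂ Y₂ ⟩
      + suc (suc m) * ((+ suc m - + i) * + suc i * X₂) * (+ suc (suc m) * + suc m * Y₂)
        ≡⟨ cong₂ (λ x y → + suc (suc m) * x * y) (binom-absorb-shift m i) (binom-absorb² (N ℕ.+ N) m) ⟩
      + suc (suc m) * (+ suc (suc m) * + suc m * X₀) * (+ suc (suc (N ℕ.+ N)) * + suc (N ℕ.+ N) * Y₀)
        ≡⟨ polynomial (+ i) (+ N) X₀ Y₀ ⟩
      + 2 * (+ 2 * + m + + 3) * + suc N * + suc (suc m) * (+ suc m * X₀) * ((+ (N ℕ.+ N) - + m) * Y₀) + + 4 * + suc m * (G * (X₀ * Y₀))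
        ≡⟨ cong₂ (λ x y → + 2 * (+ 2 * + m + + 3) * + suc N * + suc (suc m) * x * y + + 4 * + suc m * (G * (X₀ * Y₀)))
                 (binom-absorb m i) (binom-drop (N ℕ.+ N) m) ⟨
      + 2 * (+ 2 * + m + + 3) * + suc N * + suc (suc m) * (+ suc i * X₁) * (+ suc m * Y₁) + + 4 * + suc m * (G * (X₀ * Y₀))
        ≡⟨ regroup₀₁ (+ i) (+ N) X₁ Y₁ (X₀ * Y₀) ⟩
      G * (+ 2 * (+ 2 * + m + + 3) * (X₁ * Y₁) + + 4 * + suc m * (X₀ * Y₀))
        ≡⟨ cong₂ (λ x y → G * (+ 2 * (+ 2 * + m + + 3) * x + + 4 * + suc m * y))
                 (rodrigues-binom (suc m) (suc i) (m+n∸m≡n i N)) (rodrigues-binom m i (m+n∸m≡n i N)) ⟨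
      G * (+ 2 * (+ 2 * + m + + 3) * + rodriguesCoeff (suc m) (suc i) + + 4 * + suc m * + rodriguesCoeff m i) ∎)
      where
      open ≡-Reasoning
      m = i ℕ.+ N
      G = + suc N * + suc i * (+ suc (suc m) * + suc m)
      X₀ = binom m i
      X₁ = binom (suc m) (suc i)
      X₂ = binom (suc (suc m)) (suc i)
      Y₀ = binom (N ℕ.+ N) m
      Y₁ = binom (N ℕ.+ N) (suc m)
      Y₂ = binom (suc (suc (N ℕ.+ N))) (suc (suc m))
      regroup₂ : ∀ i N x y → let m = i + N in
        (1ℤ + N) * (1ℤ + i) * ((1ℤ + (1ℤ + m)) * (1ℤ + m)) * ((1ℤ + (1ℤ + m)) * (x * y))
        ≡ (1ℤ + (1ℤ + m)) * ((1ℤ + m - i) * (1ℤ + i) * x) * ((1ℤ + (1ℤ + m)) * (1ℤ + m) * y)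
      regroup₂ = solve-∀
      polynomial : ∀ i N x y → let m = i + N in
        (1ℤ + (1ℤ + m)) * ((1ℤ + (1ℤ + m)) * (1ℤ + m) * x) * ((1ℤ + (1ℤ + (N + N))) * (1ℤ + (N + N)) * y)
        ≡ + 2 * (+ 2 * m + + 3) * (1ℤ + N) * (1ℤ + (1ℤ + m)) * ((1ℤ + m) * x) * ((N + N - m) * y)
          + + 4 * (1ℤ + m) * ((1ℤ + N) * (1ℤ + i) * ((1ℤ + (1ℤ + m)) * (1ℤ + m)) * (x * y))
      polynomial = solve-∀
      regroup₀₁ : ∀ i N x y z → let m = i + N in
        + 2 * (+ 2 * m + + 3) * (1ℤ + N) * (1ℤ + (1ℤ + m)) * ((1ℤ + i) * x) * ((1ℤ + m) * y)
          + + 4 * (1ℤ + m) * ((1ℤ + N) * (1ℤ + i) * ((1ℤ + (1ℤ + m)) * (1ℤ + m)) * z)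
        ≡ (1ℤ + N) * (1ℤ + i) * ((1ℤ + (1ℤ + m)) * (1ℤ + m)) * (+ 2 * (+ 2 * m + + 3) * (x * y) + + 4 * (1ℤ + m) * z)
      regroup₀₁ = solve-∀

  rodriguesCoeff-rec : ∀ m i →
    + suc (suc m) * + rodriguesCoeff (suc (suc m)) (suc i)
    ≡ + 2 * (+ 2 * + m + + 3) * + rodriguesCoeff (suc m) (suc i) + + 4 * + suc m * + rodriguesCoeff m i
  rodriguesCoeff-rec m i with i ≤? m
  ... | yes i≤m with m≤n⇒∃[o]m+o≡n i≤m
  ...   | N , refl = rodriguesCoeff-rec-≤ i N
  rodriguesCoeff-rec m i | no i≰m
    rewrite rodriguesCoeff-vanish {suc (suc m)} {suc i} (s≤s (≤-trans (s≤s (≰⇒> i≰m)) (m≤n+m (suc i) i)))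
          | rodriguesCoeff-vanish {suc m} {suc i} (s≤s (≤-trans (≰⇒> i≰m) (m≤m+n i (suc i))))
          | rodriguesCoeff-vanish {m} {i} (<-≤-trans (≰⇒> i≰m) (m≤m+n i i))
    = zeros (+ suc (suc m)) (+ 2 * (+ 2 * + m + + 3)) (+ 4 * + suc m)
    where
    zeros : ∀ a b c → a * 0ℤ ≡ b * 0ℤ + c * 0ℤ
    zeros = solve-∀

  rodriguesCoeff-ratio : ∀ j e → let n = suc (j ℕ.+ suc (j ℕ.+ e)) in
    rodriguesCoeff n j ℕ.* ((2 ℕ.+ e) ℕ.* (1 ℕ.+ e))
    ≡ rodriguesCoeff n (suc j) ℕ.* ((suc j ℕ.+ suc j) ℕ.* (3 ℕ.+ (j ℕ.+ e) ℕ.+ (j ℕ.+ e)))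
  rodriguesCoeff-ratio j e = +-injective (begin
    + (rodriguesCoeff n j ℕ.* ((2 ℕ.+ e) ℕ.* (1 ℕ.+ e)))
      ≡⟨ pos-*² (rodriguesCoeff n j) (2 ℕ.+ e) (1 ℕ.+ e) ⟩
    + rodriguesCoeff n j * ((+ 2 + + e) * (1ℤ + + e))
      ≡⟨ cong (_* ((+ 2 + + e) * (1ℤ + + e))) (rodrigues-binom-suc n j (suc-∸ j M)) ⟩
    binom n j * binom (suc (suc (M ℕ.+ M))) n * ((+ 2 + + e) * (1ℤ + + e))
      ≡⟨ regroup (+ j) (+ e) (binom n j) (binom (suc (suc (M ℕ.+ M))) n) ⟩
    binom n j * ((+ suc (suc (M ℕ.+ M)) - + n) * (+ suc (M ℕ.+ M) - + n) * binom (suc (suc (M ℕ.+ M))) n)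
      ≡⟨ cong (binom n j *_) (binom-shift² (M ℕ.+ M) n) ⟩
    binom n j * (+ suc (suc (M ℕ.+ M)) * + suc (M ℕ.+ M) * binom (M ℕ.+ M) n)
      ≡⟨ regroup′ (+ j) (+ e) (binom n j) (binom (M ℕ.+ M) n) ⟩
    ((+ n - + j) * binom n j) * binom (M ℕ.+ M) n * (+ 2 * (+ 3 + (+ j + + e) + (+ j + + e)))
      ≡⟨ cong (λ x → x * binom (M ℕ.+ M) n * (+ 2 * (+ 3 + (+ j + + e) + (+ j + + e)))) (binom-drop n j) ⟨
    (+ suc j * binom n (suc j)) * binom (M ℕ.+ M) n * (+ 2 * (+ 3 + (+ j + + e) + (+ j + + e)))
      ≡⟨ regroup″ (+ j) (+ e) (binom n (suc j)) (binom (M ℕ.+ M) n) ⟩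
    binom n (suc j) * binom (M ℕ.+ M) n * ((+ suc j + + suc j) * (+ 3 + (+ j + + e) + (+ j + + e)))
      ≡⟨ cong (_* ((+ suc j + + suc j) * (+ 3 + (+ j + + e) + (+ j + + e)))) (rodrigues-binom n (suc j) (m+n∸m≡n j M)) ⟨
    + rodriguesCoeff n (suc j) * ((+ suc j + + suc j) * (+ 3 + (+ j + + e) + (+ j + + e)))
      ≡⟨ pos-*² (rodriguesCoeff n (suc j)) (suc j ℕ.+ suc j) (3 ℕ.+ (j ℕ.+ e) ℕ.+ (j ℕ.+ e)) ⟨
    + (rodriguesCoeff n (suc j) ℕ.* ((suc j ℕ.+ suc j) ℕ.* (3 ℕ.+ (j ℕ.+ e) ℕ.+ (j ℕ.+ e)))) ∎)
    where
    open ≡-Reasoning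
    M = suc (j ℕ.+ e)
    n = suc (j ℕ.+ M)
    pos-*² : ∀ a b c → + (a ℕ.* (b ℕ.* c)) ≡ + a * (+ b * + c)
    pos-*² a b c = trans (pos-* a (b ℕ.* c)) (cong (+ a *_) (pos-* b c))
    regroup : ∀ j e x y → let M = 1ℤ + (j + e) ; n = 1ℤ + (j + M) in
      x * y * ((+ 2 + e) * (1ℤ + e)) ≡ x * ((1ℤ + (1ℤ + (M + M)) - n) * (1ℤ + (M + M) - n) * y)
    regroup = solve-∀
    regroup′ : ∀ j e x y → let M = 1ℤ + (j + e) ; n = 1ℤ + (j + M) in
      x * ((1ℤ + (1ℤ + (M + M))) * (1ℤ + (M + M)) * y) ≡ ((n - j) * x) * y * (+ 2 * (+ 3 + (j + e) + (j + e)))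
    regroup′ = solve-∀
    regroup″ : ∀ j e x y →
      ((1ℤ + j) * x) * y * (+ 2 * (+ 3 + (j + e) + (j + e))) ≡ x * y * ((1ℤ + j + (1ℤ + j)) * (+ 3 + (j + e) + (j + e)))
    regroup″ = solve-∀

  rodriguesCoeff-central : ∀ m → rodriguesCoeff (m ℕ.+ m) m ≡ (m ℕ.+ m) C m
  rodriguesCoeff-central m = begin
    ((m ℕ.+ m) C m) ℕ.* ((d ℕ.+ d) C (m ℕ.+ m)) ≡⟨ cong (λ e → ((m ℕ.+ m) C m) ℕ.* ((e ℕ.+ e) C (m ℕ.+ m))) (m+n∸m≡n m m) ⟩
    ((m ℕ.+ m) C m) ℕ.* ((m ℕ.+ m) C (m ℕ.+ m)) ≡⟨ cong (((m ℕ.+ m) C m) ℕ.*_) (nCn≡1 (m ℕ.+ m)) ⟩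
    ((m ℕ.+ m) C m) ℕ.* 1                       ≡⟨ *-identityʳ ((m ℕ.+ m) C m) ⟩
    (m ℕ.+ m) C m                               ∎
    where
    open ≡-Reasoning
    d = m ℕ.+ m ∸ m

  rodriguesCoeff-central-odd : ∀ m → rodriguesCoeff (suc (m ℕ.+ m)) m ≡ 2 ℕ.* (suc (m ℕ.+ m) ℕ.* ((m ℕ.+ m) C m))
  rodriguesCoeff-central-odd m = +-injective (begin
    + rodriguesCoeff N m            ≡⟨ rodrigues-binom-suc N m (suc-∸ m m) ⟩
    binom N m * binom (suc N) N     ≡⟨ cong (binom N m *_) (binom-suc-self N) ⟩
    binom N m * + suc N             ≡⟨ regroup (+ m) (binom N m) ⟩
    + 2 * ((+ N - + m) * binom N m) ≡⟨ cong (+ 2 *_) (binom-shift (m ℕ.+ m) m) ⟩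
    + 2 * (+ N * binom (m ℕ.+ m) m) ≡⟨ trans (pos-* 2 (N ℕ.* B)) (cong (+ 2 *_) (pos-* N B)) ⟨
    + (2 ℕ.* (N ℕ.* B))             ∎)
    where
    open ≡-Reasoning
    N = suc (m ℕ.+ m)
    B = (m ℕ.+ m) C m
    regroup : ∀ m x → x * (1ℤ + (1ℤ + (m + m))) ≡ + 2 * ((1ℤ + (m + m) - m) * x)
    regroup = solve-∀

module LegendreExpansion where

  open import Data.Nat as ℕ using (ℕ; zero; suc; _∸_; _<_; s≤s; _≤?_)
  open import Data.Nat.Properties using (+-suc; +-∸-assoc; ≤-trans; ≤-reflexive; ≰⇒>; <-≤-trans; m≤m+n)
  open import Data.Nat.Combinatorics using (_C_; k>n⇒nCk≡0)
  open import Data.Integer using (ℤ; +_; 0ℤ; 1ℤ; -1ℤ; _+_; _-_; -_; _*_; _^_)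
  open import Data.Integer.Properties using (*-cancelˡ-≡; *-zeroʳ; +-0-abelianGroup)
  open import Data.Integer.Tactic.RingSolver using (solve-∀)
  open import Algebra.Bundles using (AbelianGroup)
  open import Algebra.Properties.Group (AbelianGroup.group +-0-abelianGroup) using (∙-cancelʳ)
  open import Data.Product using (_×_; _,_; proj₁)
  open import Relation.Nullary using (yes; no)
  open import Relation.Binary.PropositionalEquality
  open LegendreCoefficients
  open RodriguesCoefficients
  open IntegerSums

  legendreTerm : ℤ → ℕ → ℕ → ℤ
  legendreTerm x n k = + legendreCoeff n k * x ^ k

  -- Pₙ(1 + 2x)
  legendreSum : ℤ → ℕ → ℤ
  legendreSum x n = sumToℤ n (legendreTerm x n)

  rodriguesTerm : ℤ → ℕ → ℕ → ℤ
  rodriguesTerm y n j = -1ℤ ^ j * + rodriguesCoeff n j * y ^ (n ∸ (j ℕ.+ j))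

  rodriguesSum : ℤ → ℕ → ℤ
  rodriguesSum y n = sumToℤ n (rodriguesTerm y n)

  rodriguesTerm-vanish : ∀ y n k → n < k ℕ.+ k → rodriguesTerm y n k ≡ 0ℤ
  rodriguesTerm-vanish y n k n<2k = begin
    -1ℤ ^ k * + rodriguesCoeff n k * Y ≡⟨ cong (λ c → -1ℤ ^ k * + c * Y) (rodriguesCoeff-vanish {n} {k} n<2k) ⟩
    -1ℤ ^ k * 0ℤ * Y                   ≡⟨ cong (_* Y) (*-zeroʳ (-1ℤ ^ k)) ⟩
    0ℤ                                 ∎
    where
    open ≡-Reasoning
    Y = y ^ (n ∸ (k ℕ.+ k))

  private
    rodriguesCoeff-pow : ∀ y m i →
      + rodriguesCoeff (suc m) (suc i) * y ^ (m ∸ (i ℕ.+ i))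
      ≡ y * (+ rodriguesCoeff (suc m) (suc i) * y ^ (m ∸ (i ℕ.+ suc i)))
    rodriguesCoeff-pow y m i rewrite +-suc i i with suc (i ℕ.+ i) ≤? m
    ... | yes 2i<m rewrite +-∸-assoc 1 2i<m = swap (+ rodriguesCoeff (suc m) (suc i)) y _
      where swap : ∀ a y b → a * (y * b) ≡ y * (a * b)
            swap = solve-∀
    ... | no 2i≮m
      rewrite rodriguesCoeff-vanish {suc m} {suc i} (s≤s (≤-trans (≰⇒> 2i≮m) (≤-reflexive (sym (+-suc i i)))))
      = zeros y (y ^ (m ∸ (i ℕ.+ i))) (y ^ (m ∸ suc (i ℕ.+ i)))
      where zeros : ∀ y a b → 0ℤ * a ≡ y * (0ℤ * b)
            zeros = solve-∀

  rodriguesTerm-rec : ∀ y m j →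
    + suc (suc m) * rodriguesTerm y (suc (suc m)) j + + 4 * + suc m * delay (rodriguesTerm y m) j
    ≡ + 2 * (+ 2 * + m + + 3) * y * rodriguesTerm y (suc m) j
  rodriguesTerm-rec y m zero = begin
    + suc (suc m) * (1ℤ * c₂ * y ^ suc (suc m)) + + 4 * + suc m * 0ℤ ≡⟨ regroup (+ suc (suc m)) c₂ (y ^ suc (suc m)) (+ 4 * + suc m) ⟩
    + suc (suc m) * c₂ * y ^ suc (suc m)                             ≡⟨ cong (_* y ^ suc (suc m)) (rodriguesCoeff-rec₀ (suc m)) ⟩
    + 2 * (+ 2 * + suc m + 1ℤ) * c₁ * (y * y ^ suc m)                ≡⟨ regroup′ (+ m) c₁ y (y ^ suc m) ⟩
    + 2 * (+ 2 * + m + + 3) * y * (1ℤ * c₁ * y ^ suc m)              ∎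
    where
    open ≡-Reasoning
    c₁ = + rodriguesCoeff (suc m) 0
    c₂ = + rodriguesCoeff (suc (suc m)) 0
    regroup : ∀ a c Y b → a * (1ℤ * c * Y) + b * 0ℤ ≡ a * c * Y
    regroup = solve-∀
    regroup′ : ∀ m c y Y → + 2 * (+ 2 * (1ℤ + m) + 1ℤ) * c * (y * Y) ≡ + 2 * (+ 2 * m + + 3) * y * (1ℤ * c * Y)
    regroup′ = solve-∀
  rodriguesTerm-rec y m (suc i) = begin
    + suc (suc m) * (-1ℤ * s * c₂ * y ^ (suc m ∸ (i ℕ.+ suc i))) + + 4 * + suc m * (s * c₀ * E)
      ≡⟨ cong (λ e → + suc (suc m) * (-1ℤ * s * c₂ * y ^ (suc m ∸ e)) + + 4 * + suc m * (s * c₀ * E)) (+-suc i i) ⟩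
    + suc (suc m) * (-1ℤ * s * c₂ * E) + + 4 * + suc m * (s * c₀ * E)
      ≡⟨ regroup (+ suc (suc m)) (+ 4 * + suc m) s c₂ c₀ E ⟩
    - (s * E) * (+ suc (suc m) * c₂) + s * E * (+ 4 * + suc m * c₀)
      ≡⟨ cong (λ x → - (s * E) * x + s * E * (+ 4 * + suc m * c₀)) (rodriguesCoeff-rec m i) ⟩
    - (s * E) * (+ 2 * (+ 2 * + m + + 3) * c₁ + + 4 * + suc m * c₀) + s * E * (+ 4 * + suc m * c₀)
      ≡⟨ regroup′ (+ 2 * (+ 2 * + m + + 3)) (+ 4 * + suc m) s c₁ c₀ E ⟩
    + 2 * (+ 2 * + m + + 3) * (-1ℤ * s) * (c₁ * E)
      ≡⟨ cong (+ 2 * (+ 2 * + m + + 3) * (-1ℤ * s) *_) (rodriguesCoeff-pow y m i) ⟩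
    + 2 * (+ 2 * + m + + 3) * (-1ℤ * s) * (y * (c₁ * y ^ (m ∸ (i ℕ.+ suc i))))
      ≡⟨ regroup″ (+ 2 * (+ 2 * + m + + 3)) s c₁ y (y ^ (m ∸ (i ℕ.+ suc i))) ⟩
    + 2 * (+ 2 * + m + + 3) * y * (-1ℤ * s * c₁ * y ^ (m ∸ (i ℕ.+ suc i))) ∎
    where
    open ≡-Reasoning
    s = -1ℤ ^ i
    c₀ = + rodriguesCoeff m i
    c₁ = + rodriguesCoeff (suc m) (suc i)
    c₂ = + rodriguesCoeff (suc (suc m)) (suc i)
    E = y ^ (m ∸ (i ℕ.+ i))
    regroup : ∀ a b s c₂ c₀ E → a * (-1ℤ * s * c₂ * E) + b * (s * c₀ * E) ≡ - (s * E) * (a * c₂) + s * E * (b * c₀)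
    regroup = solve-∀
    regroup′ : ∀ a b s c₁ c₀ E → - (s * E) * (a * c₁ + b * c₀) + s * E * (b * c₀) ≡ a * (-1ℤ * s) * (c₁ * E)
    regroup′ = solve-∀
    regroup″ : ∀ a s c y Y → a * (-1ℤ * s) * (y * (c * Y)) ≡ a * y * (-1ℤ * s * c * Y)
    regroup″ = solve-∀

  private
    legendreTerm-vanish : ∀ x {n k} → n < k → legendreTerm x n k ≡ 0ℤ
    legendreTerm-vanish x {n} {k} n<k = cong (λ c → + (c ℕ.* ((n ℕ.+ k) C k)) * x ^ k) (k>n⇒nCk≡0 n<k)

    legendreTerm-rec : ∀ x m k →
      + suc (suc m) * legendreTerm x (suc (suc m)) k + + suc m * legendreTerm x m k
      ≡ (+ 2 * + m + + 3) * (legendreTerm x (suc m) k + + 2 * x * delay (legendreTerm x (suc m)) k)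
    legendreTerm-rec x m zero = constant (+ m) x
      where constant : ∀ m x → (1ℤ + (1ℤ + m)) * (1ℤ * 1ℤ) + (1ℤ + m) * (1ℤ * 1ℤ) ≡ (+ 2 * m + + 3) * (1ℤ * 1ℤ + + 2 * x * 0ℤ)
            constant = solve-∀
    legendreTerm-rec x m (suc k) = begin
      + suc (suc m) * (A₂ * (x * x ^ k)) + + suc m * (A₀ * (x * x ^ k))
        ≡⟨ factor (+ suc (suc m)) (+ suc m) A₂ A₀ (x * x ^ k) ⟩
      (+ suc (suc m) * A₂ + + suc m * A₀) * (x * x ^ k)
        ≡⟨ cong (_* (x * x ^ k)) (legendreCoeff-rec m k) ⟩
      (+ 2 * + m + + 3) * (A₁ + + 2 * + legendreCoeff (suc m) k) * (x * x ^ k)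
        ≡⟨ expand (+ 2 * + m + + 3) A₁ (+ legendreCoeff (suc m) k) x (x ^ k) ⟩
      (+ 2 * + m + + 3) * (A₁ * (x * x ^ k) + + 2 * x * (+ legendreCoeff (suc m) k * x ^ k)) ∎
      where
      open ≡-Reasoning
      A₀ = + legendreCoeff m (suc k)
      A₁ = + legendreCoeff (suc m) (suc k)
      A₂ = + legendreCoeff (suc (suc m)) (suc k)
      factor : ∀ a b u v X → a * (u * X) + b * (v * X) ≡ (a * u + b * v) * X
      factor = solve-∀
      expand : ∀ c u v x X → c * (u + + 2 * v) * (x * X) ≡ c * (u * (x * X) + + 2 * x * (v * X))
      expand = solve-∀

  legendreSum-rec : ∀ x m →
    + suc (suc m) * legendreSum x (suc (suc m)) + + suc m * legendreSum x m
    ≡ (+ 2 * + m + + 3) * (1ℤ + + 2 * x) * legendreSum x (suc m)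
  legendreSum-rec x m = begin
    + suc (suc m) * legendreSum x (suc (suc m)) + + suc m * legendreSum x m
      ≡⟨ cong (λ s → + suc (suc m) * legendreSum x (suc (suc m)) + + suc m * s)
              (sumToℤ-extend m 2 (legendreTerm x m) (λ k → legendreTerm-vanish x)) ⟨
    + suc (suc m) * legendreSum x (suc (suc m)) + + suc m * sumToℤ (suc (suc m)) (legendreTerm x m)
      ≡⟨ sumToℤ-linear (suc (suc m)) (+ suc (suc m)) (+ suc m) (legendreTerm x (suc (suc m))) (legendreTerm x m) ⟨
    sumToℤ (suc (suc m)) (λ k → + suc (suc m) * legendreTerm x (suc (suc m)) k + + suc m * legendreTerm x m k)
      ≡⟨ sumToℤ-cong (suc (suc m)) (legendreTerm-rec x m) ⟩
    sumToℤ (suc (suc m)) (λ k → (+ 2 * + m + + 3) * (legendreTerm x (suc m) k + + 2 * x * delay (legendreTerm x (suc m)) k))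
      ≡⟨ sumToℤ-* (suc (suc m)) (+ 2 * + m + + 3) _ ⟩
    (+ 2 * + m + + 3) * sumToℤ (suc (suc m)) (λ k → legendreTerm x (suc m) k + + 2 * x * delay (legendreTerm x (suc m)) k)
      ≡⟨ cong ((+ 2 * + m + + 3) *_) (trans (sumToℤ-+ (suc (suc m)) _ _) (cong (_+_ (sumToℤ (suc (suc m)) T₁)) (sumToℤ-* (suc (suc m)) (+ 2 * x) _))) ⟩
    (+ 2 * + m + + 3) * (sumToℤ (suc (suc m)) (legendreTerm x (suc m)) + + 2 * x * sumToℤ (suc (suc m)) (delay (legendreTerm x (suc m))))
      ≡⟨ cong₂ (λ u v → (+ 2 * + m + + 3) * (u + + 2 * x * v))
               (sumToℤ-extend (suc m) 1 (legendreTerm x (suc m)) (λ k → legendreTerm-vanish x))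
               (sumToℤ-delay (suc m) (legendreTerm x (suc m))) ⟩
    (+ 2 * + m + + 3) * (legendreSum x (suc m) + + 2 * x * legendreSum x (suc m))
      ≡⟨ factor (+ 2 * + m + + 3) x (legendreSum x (suc m)) ⟩
    (+ 2 * + m + + 3) * (1ℤ + + 2 * x) * legendreSum x (suc m) ∎
    where
    open ≡-Reasoning
    T₁ = legendreTerm x (suc m)
    factor : ∀ c x L → c * (L + + 2 * x * L) ≡ c * (1ℤ + + 2 * x) * L
    factor = solve-∀

  rodriguesSum-rec : ∀ y m →
    + suc (suc m) * rodriguesSum y (suc (suc m)) + + 4 * + suc m * rodriguesSum y m
    ≡ + 2 * (+ 2 * + m + + 3) * y * rodriguesSum y (suc m)
  rodriguesSum-rec y m = begin
    + suc (suc m) * rodriguesSum y (suc (suc m)) + + 4 * + suc m * rodriguesSum y m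
      ≡⟨ cong (λ s → + suc (suc m) * rodriguesSum y (suc (suc m)) + + 4 * + suc m * s)
              (trans (sumToℤ-delay (suc m) (rodriguesTerm y m)) (sumToℤ-extend m 1 (rodriguesTerm y m) (vanish m))) ⟨
    + suc (suc m) * rodriguesSum y (suc (suc m)) + + 4 * + suc m * sumToℤ (suc (suc m)) (delay (rodriguesTerm y m))
      ≡⟨ sumToℤ-linear (suc (suc m)) (+ suc (suc m)) (+ 4 * + suc m) (rodriguesTerm y (suc (suc m))) (delay (rodriguesTerm y m)) ⟨
    sumToℤ (suc (suc m)) (λ j → + suc (suc m) * rodriguesTerm y (suc (suc m)) j + + 4 * + suc m * delay (rodriguesTerm y m) j)
      ≡⟨ sumToℤ-cong (suc (suc m)) (rodriguesTerm-rec y m) ⟩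
    sumToℤ (suc (suc m)) (λ j → + 2 * (+ 2 * + m + + 3) * y * rodriguesTerm y (suc m) j)
      ≡⟨ sumToℤ-* (suc (suc m)) (+ 2 * (+ 2 * + m + + 3) * y) (rodriguesTerm y (suc m)) ⟩
    + 2 * (+ 2 * + m + + 3) * y * sumToℤ (suc (suc m)) (rodriguesTerm y (suc m))
      ≡⟨ cong (+ 2 * (+ 2 * + m + + 3) * y *_) (sumToℤ-extend (suc m) 1 (rodriguesTerm y (suc m)) (vanish (suc m))) ⟩
    + 2 * (+ 2 * + m + + 3) * y * rodriguesSum y (suc m) ∎
    where
    open ≡-Reasoning
    vanish : ∀ n k → n < k → rodriguesTerm y n k ≡ 0ℤ
    vanish n k n<k = rodriguesTerm-vanish y n k (<-≤-trans n<k (m≤m+n k k))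

  recurrence-unique : ∀ (b c u v : ℕ → ℤ) →
    (∀ m → + suc (suc m) * u (suc (suc m)) + b m * u m ≡ c m * u (suc m)) →
    (∀ m → + suc (suc m) * v (suc (suc m)) + b m * v m ≡ c m * v (suc m)) →
    u 0 ≡ v 0 → u 1 ≡ v 1 → ∀ n → u n ≡ v n
  recurrence-unique b c u v u-rec v-rec u₀≡v₀ u₁≡v₁ n = proj₁ (agree n)
    where
    agree : ∀ n → u n ≡ v n × u (suc n) ≡ v (suc n)
    agree zero = u₀≡v₀ , u₁≡v₁
    agree (suc m) with agree m
    ... | uₘ≡vₘ , uₘ₊₁≡vₘ₊₁ = uₘ₊₁≡vₘ₊₁ , *-cancelˡ-≡ (+ suc (suc m)) _ _ (∙-cancelʳ (b m * v m) _ _ (begin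
      + suc (suc m) * u (suc (suc m)) + b m * v m ≡⟨ cong (λ w → + suc (suc m) * u (suc (suc m)) + b m * w) uₘ≡vₘ ⟨
      + suc (suc m) * u (suc (suc m)) + b m * u m ≡⟨ u-rec m ⟩
      c m * u (suc m)                             ≡⟨ cong (c m *_) uₘ₊₁≡vₘ₊₁ ⟩
      c m * v (suc m)                             ≡⟨ v-rec m ⟨
      + suc (suc m) * v (suc (suc m)) + b m * v m ∎))
      where open ≡-Reasoning

  legendre-expansion : ∀ x n → (+ 2) ^ n * legendreSum x n ≡ rodriguesSum (1ℤ + + 2 * x) n
  legendre-expansion x = recurrence-unique (λ m → + 4 * + suc m) (λ m → + 2 * (+ 2 * + m + + 3) * (1ℤ + + 2 * x))
    (λ n → (+ 2) ^ n * legendreSum x n) (rodriguesSum (1ℤ + + 2 * x)) scaled-rec (rodriguesSum-rec (1ℤ + + 2 * x)) refl (base₁ x)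
    where
    base₁ : ∀ x → + 2 * 1ℤ * (1ℤ * 1ℤ + + 2 * (x * 1ℤ)) ≡ 1ℤ * + 2 * ((1ℤ + + 2 * x) * 1ℤ) + -1ℤ * 1ℤ * 0ℤ * 1ℤ
    base₁ = solve-∀
    scaled-rec : ∀ m → + suc (suc m) * ((+ 2) ^ suc (suc m) * legendreSum x (suc (suc m))) + + 4 * + suc m * ((+ 2) ^ m * legendreSum x m)
                 ≡ + 2 * (+ 2 * + m + + 3) * (1ℤ + + 2 * x) * ((+ 2) ^ suc m * legendreSum x (suc m))
    scaled-rec m = begin
      + suc (suc m) * ((+ 2) ^ suc (suc m) * legendreSum x (suc (suc m))) + + 4 * + suc m * ((+ 2) ^ m * legendreSum x m)
        ≡⟨ scale ((+ 2) ^ m) (+ suc (suc m)) (+ suc m) (legendreSum x (suc (suc m))) (legendreSum x m) ⟩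
      + 4 * (+ 2) ^ m * (+ suc (suc m) * legendreSum x (suc (suc m)) + + suc m * legendreSum x m)
        ≡⟨ cong (+ 4 * (+ 2) ^ m *_) (legendreSum-rec x m) ⟩
      + 4 * (+ 2) ^ m * ((+ 2 * + m + + 3) * (1ℤ + + 2 * x) * legendreSum x (suc m))
        ≡⟨ unscale ((+ 2) ^ m) (+ 2 * + m + + 3) (1ℤ + + 2 * x) (legendreSum x (suc m)) ⟩
      + 2 * (+ 2 * + m + + 3) * (1ℤ + + 2 * x) * ((+ 2) ^ suc m * legendreSum x (suc m)) ∎
      where
      open ≡-Reasoning
      scale : ∀ P a b L₂ L₀ → a * (+ 2 * (+ 2 * P) * L₂) + + 4 * b * (P * L₀) ≡ + 4 * P * (a * L₂ + b * L₀)
      scale = solve-∀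
      unscale : ∀ P c y L → + 4 * P * (c * y * L) ≡ + 2 * c * y * (+ 2 * P * L)
      unscale = solve-∀

module Valuation where

  open import Data.Nat
  open import Data.Nat.Properties
  open import Data.Nat.Divisibility
  open import Data.Nat.DivMod using (m*n/n≡m)
  open import Data.Nat.Primality using (Prime; euclidsLemma)
  open import Data.Nat.Tactic.RingSolver using (solve-∀)
  open import Data.Empty using (⊥-elim)
  open import Data.Product using (_×_; _,_; proj₁; proj₂)
  open import Data.Sum using (inj₁; inj₂)
  open import Relation.Nullary using (¬_; yes; no)
  open import Relation.Binary.PropositionalEquality
  open import Relation.Binary.Definitions using (tri<; tri≈; tri>)
  open import Defs using (valFuel; ν)

  *-pos : ∀ {a b} → 0 < a → 0 < b → 0 < a * b
  *-pos {suc a} {suc b} _ _ = z<s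

  valFuel-exact : ∀ {p} → 1 < p → ∀ f x → 0 < x → x ≤ f →
    p ^ valFuel f p x ∣ x × ¬ p ^ suc (valFuel f p x) ∣ x
  valFuel-exact {suc (suc q)} 1<p (suc f) (suc m) 0<x (s≤s m≤f) with suc (suc q) ∣? suc m
  ... | no p∤x = 1∣ suc m , λ p¹∣x → p∤x (subst (_∣ suc m) (*-identityʳ (suc (suc q))) p¹∣x)
  ... | yes (divides y@(suc _) x≡yp) =
    subst (λ z → p ^ suc (valFuel f p z) ∣ suc m × ¬ p ^ suc (suc (valFuel f p z)) ∣ suc m) (sym x/p≡y)
      ( subst (p ^ suc v ∣_) (sym x≡py) (*-monoʳ-∣ p p^v∣y)
      , λ p^v+2∣x → p^v+1∤y (*-cancelˡ-∣ p (subst (p * p ^ suc v ∣_) x≡py p^v+2∣x)))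
    where
    p = suc (suc q)
    x≡py : suc m ≡ p * y
    x≡py = trans x≡yp (*-comm y p)
    x/p≡y : suc m / p ≡ y
    x/p≡y = trans (cong (_/ p) x≡yp) (m*n/n≡m y p)
    y≤f : y ≤ f
    y≤f = ≤-trans (s≤s⁻¹ (≤-trans (m<m*n y p 1<p) (≤-reflexive (sym x≡yp)))) m≤f
    v = valFuel f p y
    p^v∣y = proj₁ (valFuel-exact 1<p f y z<s y≤f)
    p^v+1∤y = proj₂ (valFuel-exact 1<p f y z<s y≤f)
  valFuel-exact {1} (s≤s ()) _ _ _ _

  pow-mono-∣ : ∀ p {a b} → a ≤ b → p ^ a ∣ p ^ b
  pow-mono-∣ p {a} a≤b with m≤n⇒∃[o]m+o≡n a≤b
  ... | o , refl = subst (p ^ a ∣_) (sym (^-distribˡ-+-* p a o)) (m∣m*n (p ^ o))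

  module _ {p : ℕ} (1<p : 1 < p) where

    private instance
      p≢0 : NonZero p
      p≢0 = >-nonZero (<-trans z<s 1<p)

    p^ν∣ : ∀ {x} → 0 < x → p ^ ν p x ∣ x
    p^ν∣ {x} 0<x = proj₁ (valFuel-exact 1<p x x 0<x ≤-refl)

    p^1+ν∤ : ∀ {x} → 0 < x → ¬ p ^ suc (ν p x) ∣ x
    p^1+ν∤ {x} 0<x = proj₂ (valFuel-exact 1<p x x 0<x ≤-refl)

    pow∣⇒≤ν : ∀ {x k} → 0 < x → p ^ k ∣ x → k ≤ ν p x
    pow∣⇒≤ν {x} {k} 0<x p^k∣x with k ≤? ν p x
    ... | yes k≤ν = k≤ν
    ... | no  k≰ν = ⊥-elim (p^1+ν∤ 0<x (∣-trans (pow-mono-∣ p (≰⇒> k≰ν)) p^k∣x))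

    ν-unique : ∀ {x v} → 0 < x → p ^ v ∣ x → ¬ p ^ suc v ∣ x → ν p x ≡ v
    ν-unique {x} {v} 0<x p^v∣x p^1+v∤x with <-cmp (ν p x) v
    ... | tri< ν<v _ _ = ⊥-elim (p^1+ν∤ 0<x (∣-trans (pow-mono-∣ p ν<v) p^v∣x))
    ... | tri≈ _ ν≡v _ = ν≡v
    ... | tri> _ _ v<ν = ⊥-elim (p^1+v∤x (∣-trans (pow-mono-∣ p v<ν) (p^ν∣ 0<x)))

    ν-coprime : ∀ {x} → ¬ p ∣ x → ν p x ≡ 0
    ν-coprime {zero}  p∤x = ⊥-elim (p∤x (p ∣0))
    ν-coprime {suc x} p∤x = ν-unique z<s (1∣ suc x) (λ p¹∣x → p∤x (subst (_∣ suc x) (*-identityʳ p) p¹∣x))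

    ν-p* : ∀ {x} → 0 < x → ν p (p * x) ≡ suc (ν p x)
    ν-p* {x} 0<x = ν-unique (*-pos (<-trans z<s 1<p) 0<x) (*-monoʳ-∣ p (p^ν∣ 0<x)) (λ p^2+ν∣px → p^1+ν∤ 0<x (*-cancelˡ-∣ p p^2+ν∣px))

    ν-* : Prime p → ∀ {a b} → 0 < a → 0 < b → ν p (a * b) ≡ ν p a + ν p b
    ν-* p-prime {a} {b} 0<a 0<b with p^ν∣ 0<a | p^ν∣ 0<b
    ... | divides a′ a≡a′pᵃ | divides b′ b≡b′pᵇ =
      ν-unique (*-pos 0<a 0<b) (subst (P ∣_) (sym ab≡Pa′b′) (m∣m*n (a′ * b′))) p^1+v∤ab
      where
      P = p ^ (ν p a + ν p b)
      instance _ = m^n≢0 p (ν p a + ν p b)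
      ab≡Pa′b′ : a * b ≡ P * (a′ * b′)
      ab≡Pa′b′ = begin
        a * b                             ≡⟨ cong₂ _*_ a≡a′pᵃ b≡b′pᵇ ⟩
        a′ * p ^ ν p a * (b′ * p ^ ν p b) ≡⟨ interchange a′ (p ^ ν p a) b′ (p ^ ν p b) ⟩
        p ^ ν p a * p ^ ν p b * (a′ * b′) ≡⟨ cong (_* (a′ * b′)) (^-distribˡ-+-* p (ν p a) (ν p b)) ⟨
        P * (a′ * b′)                     ∎
        where
        open ≡-Reasoning
        interchange : ∀ x u y w → x * u * (y * w) ≡ u * w * (x * y)
        interchange = solve-∀
      p^1+v∤ab : ¬ p ^ suc (ν p a + ν p b) ∣ a * b
      p^1+v∤ab pP∣ab with euclidsLemma a′ b′ p-prime (*-cancelˡ-∣ P (subst₂ _∣_ (*-comm p P) ab≡Pa′b′ pP∣ab))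
      ... | inj₁ p∣a′ = p^1+ν∤ 0<a (subst (p ^ suc (ν p a) ∣_) (sym a≡a′pᵃ) (*-monoˡ-∣ (p ^ ν p a) p∣a′))
      ... | inj₂ p∣b′ = p^1+ν∤ 0<b (subst (p ^ suc (ν p b) ∣_) (sym b≡b′pᵇ) (*-monoˡ-∣ (p ^ ν p b) p∣b′))

module DigitSums where

  open import Data.Nat
  open import Data.Nat.Properties
  open import Data.Nat.DivMod
  open import Data.Nat.Divisibility using (divides)
  open import Relation.Binary.PropositionalEquality
  open import Defs using (digitFuel; s)

  private
    digitFuel-zero : ∀ f p → digitFuel f p 0 ≡ 0
    digitFuel-zero zero    p       = refl
    digitFuel-zero (suc f) zero    = refl
    digitFuel-zero (suc f) (suc q) = digitFuel-zero f (suc q)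

    digitFuel-irrelevant : ∀ {p} → 1 < p → ∀ f g x → x ≤ f → x ≤ g → digitFuel f p x ≡ digitFuel g p x
    digitFuel-irrelevant {p} _ f g zero _ _ = trans (digitFuel-zero f p) (sym (digitFuel-zero g p))
    digitFuel-irrelevant {suc (suc q)} 1<p (suc f) (suc g) (suc m) (s≤s m≤f) (s≤s m≤g) =
      cong (suc m % p +_) (digitFuel-irrelevant 1<p f g (suc m / p) (≤-trans x/p≤m m≤f) (≤-trans x/p≤m m≤g))
      where
      p = suc (suc q)
      x/p≤m : suc m / p ≤ m
      x/p≤m = s≤s⁻¹ (m/n<m (suc m) p 1<p)
    digitFuel-irrelevant {1} (s≤s ()) _ _ (suc _) _ _

  s-step : ∀ {p} .{{_ : NonZero p}} → 1 < p → ∀ {x} → 0 < x → s p x ≡ x % p + s p (x / p)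
  s-step {suc (suc q)} 1<p {suc m} _ =
    cong (suc m % p +_) (digitFuel-irrelevant 1<p m (suc m / p) (suc m / p) (s≤s⁻¹ (m/n<m (suc m) p 1<p)) ≤-refl)
    where p = suc (suc q)
  s-step {1} (s≤s ()) {suc _} _

  private
    s-digit⁺ : ∀ {p} .{{_ : NonZero p}} → 1 < p → ∀ r M → r < p → 0 < r + M * p → s p (r + M * p) ≡ r + s p M
    s-digit⁺ {p} 1<p r M r<p 0<x = begin
      s p (r + M * p)                         ≡⟨ s-step 1<p 0<x ⟩
      (r + M * p) % p + s p ((r + M * p) / p) ≡⟨ cong₂ (λ a b → a + s p b) x%p≡r x/p≡M ⟩
      r + s p M                               ∎
      where
      open ≡-Reasoning
      x%p≡r = trans ([m+kn]%n≡m%n r M p) (m<n⇒m%n≡m r<p)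
      x/p≡M = trans (+-distrib-/-∣ʳ r (divides M refl)) (cong₂ _+_ (m<n⇒m/n≡0 r<p) (m*n/n≡m M p))

  s-digit : ∀ {p} .{{_ : NonZero p}} → 1 < p → ∀ r M → r < p → s p (r + M * p) ≡ r + s p M
  s-digit {p} 1<p zero    zero    _   = refl
  s-digit {p} 1<p (suc r) M       r<p = s-digit⁺ 1<p (suc r) M r<p z<s
  s-digit {p} 1<p zero    (suc M) r<p = s-digit⁺ 1<p zero (suc M) r<p (>-nonZero⁻¹ (suc M * p) {{m*n≢0 (suc M) p}})

module LegendreFormula where

  open import Data.Nat
  open import Data.Nat.Properties
  open import Data.Nat.DivMod
  open import Data.Nat.Divisibility using (_∣_; n∣m⇒m%n≡0; ∣1⇒≡1)
  open import Data.Nat.Induction using (<-rec)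
  open import Data.Nat.Primality using (Prime; prime⇒nonTrivial)
  open import Data.Nat.Tactic.RingSolver using (solve-∀)
  open import Relation.Nullary using (¬_)
  open import Relation.Binary.PropositionalEquality
  open import Defs using (ν; s)
  open Valuation
  open DigitSums

  ν-s-pred : ∀ {p} → 1 < p → ∀ {x} → 0 < x → (p ∸ 1) * ν p x + s p x ≡ s p (pred x) + 1
  ν-s-pred {suc (suc q)} 1<p {x} = <-rec P step x
    where
    p = suc (suc q)
    P : ℕ → Set
    P x = 0 < x → suc q * ν p x + s p x ≡ s p (pred x) + 1
    digits : ∀ r M → r < p → P M → P (r + M * p)
    digits (suc r) M r<p _ _ = begin
      suc q * ν p n + s p n       ≡⟨ cong₂ (λ v d → suc q * v + d) (ν-coprime 1<p p∤n) (s-digit 1<p (suc r) M r<p) ⟩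
      suc q * 0 + (suc r + s p M) ≡⟨ cong (_+ (suc r + s p M)) (*-zeroʳ (suc q)) ⟩
      suc r + s p M               ≡⟨ +-comm 1 (r + s p M) ⟩
      r + s p M + 1               ≡⟨ cong (_+ 1) (s-digit 1<p r M (<-trans (n<1+n r) r<p)) ⟨
      s p (r + M * p) + 1         ∎
      where
      open ≡-Reasoning
      n = suc r + M * p
      p∤n : ¬ p ∣ n
      p∤n p∣n = 1+n≢0 (trans (sym (trans ([m+kn]%n≡m%n (suc r) M p) (m<n⇒m%n≡m r<p))) (n∣m⇒m%n≡0 n p p∣n))
    digits zero zero _ _ ()
    -- (M+1)·p − 1 has last digit p − 1, followed by the digits of M
    digits zero (suc M) _ ih-M _ = begin
      suc q * ν p (suc M * p) + s p (suc M * p)   ≡⟨ cong₂ (λ v d → suc q * v + d) ν[Mp]≡1+νM (s-digit 1<p 0 (suc M) z<s) ⟩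
      suc q * suc (ν p (suc M)) + s p (suc M)     ≡⟨ regroup (suc q) (ν p (suc M)) (s p (suc M)) ⟩
      suc q + (suc q * ν p (suc M) + s p (suc M)) ≡⟨ cong (suc q +_) (ih-M z<s) ⟩
      suc q + (s p M + 1)                         ≡⟨ +-assoc (suc q) (s p M) 1 ⟨
      suc q + s p M + 1                           ≡⟨ cong (_+ 1) (s-digit 1<p (suc q) M ≤-refl) ⟨
      s p (suc q + M * p) + 1                     ∎
      where
      open ≡-Reasoning
      ν[Mp]≡1+νM = trans (cong (ν p) (*-comm (suc M) p)) (ν-p* 1<p z<s)
      regroup : ∀ a v d → a * suc v + d ≡ a + (a * v + d)
      regroup = solve-∀
    step : ∀ x → (∀ {y} → y < x → P y) → P x
    step x ih 0<x = subst P (sym x≡r+Mp) (digits (x % p) (x / p) (m%n<n x p) (ih (m/n<m x p {{>-nonZero 0<x}} 1<p))) 0<x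
      where x≡r+Mp = m≡m%n+[m/n]*n x p
  ν-s-pred {1} (s≤s ())

  legendre-formula : ∀ {p} → Prime p → ∀ N → (p ∸ 1) * ν p (N !) + s p N ≡ N
  legendre-formula {p} p-prime zero = begin
    (p ∸ 1) * ν p 1 + 0 ≡⟨ cong (λ v → (p ∸ 1) * v + 0) (ν-coprime 1<p (λ p∣1 → <⇒≢ 1<p (sym (∣1⇒≡1 p∣1)))) ⟩
    (p ∸ 1) * 0 + 0     ≡⟨ cong (_+ 0) (*-zeroʳ (p ∸ 1)) ⟩
    0                   ∎
    where
    open ≡-Reasoning
    1<p = nonTrivial⇒n>1 p {{prime⇒nonTrivial p-prime}}
  legendre-formula {p} p-prime (suc N) = begin
    (p ∸ 1) * ν p (suc N * N !) + s p (suc N)                   ≡⟨ cong (λ v → (p ∸ 1) * v + s p (suc N)) (ν-* 1<p p-prime z<s (1≤n! N)) ⟩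
    (p ∸ 1) * (ν p (suc N) + ν p (N !)) + s p (suc N)           ≡⟨ regroup (p ∸ 1) (ν p (suc N)) (ν p (N !)) (s p (suc N)) ⟩
    ((p ∸ 1) * ν p (suc N) + s p (suc N)) + (p ∸ 1) * ν p (N !) ≡⟨ cong (_+ (p ∸ 1) * ν p (N !)) (ν-s-pred 1<p z<s) ⟩
    s p N + 1 + (p ∸ 1) * ν p (N !)                             ≡⟨ regroup′ (s p N) ((p ∸ 1) * ν p (N !)) ⟩
    suc ((p ∸ 1) * ν p (N !) + s p N)                           ≡⟨ cong suc (legendre-formula p-prime N) ⟩
    suc N                                                       ∎
    where
    open ≡-Reasoning
    1<p = nonTrivial⇒n>1 p {{prime⇒nonTrivial p-prime}}
    regroup : ∀ c a b d → c * (a + b) + d ≡ (c * a + d) + c * b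
    regroup = solve-∀
    regroup′ : ∀ d e → d + 1 + e ≡ suc (e + d)
    regroup′ = solve-∀

module DominantTerm where

  open import Data.Nat
  open import Data.Nat.Properties
  open import Data.Nat.Divisibility
  open import Data.Nat.Primality using (Prime)
  open import Data.Nat.Tactic.RingSolver using (solve-∀)
  open import Relation.Binary.PropositionalEquality
  open import Data.Empty using (⊥-elim)
  open import Data.Product using (_,_)
  open import Relation.Nullary using (yes; no)
  open import Defs using (ν; s)
  open RodriguesCoefficients
  open Valuation
  open LegendreFormula using (legendre-formula)

  rodriguesMagnitude : ℕ → ℕ → ℕ → ℕ
  rodriguesMagnitude p n j = rodriguesCoeff n j * p ^ (n ∸ (j + j))

  magnitude-pos : ∀ {p} → 0 < p → ∀ n j → j + j ≤ n → 0 < rodriguesMagnitude p n j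
  magnitude-pos {p} 0<p n j 2j≤n = *-pos (rodriguesCoeff-pos {n} {j} 2j≤n) (m^n>0 p {{>-nonZero 0<p}} (n ∸ (j + j)))

  magnitude-step : ∀ p j e → let n = suc (j + suc (j + e)) in
    p * p * rodriguesMagnitude p n (suc j) ∣ rodriguesMagnitude p n j * ((2 + e) * (1 + e))
  magnitude-step p j e = divides R (begin
    rodriguesCoeff n j * p ^ (n ∸ (j + j)) * X       ≡⟨ cong (λ k → rodriguesCoeff n j * p ^ k * X) (n∸2j≡2+e) ⟩
    rodriguesCoeff n j * p ^ (2 + e) * X             ≡⟨ swap (rodriguesCoeff n j) (p ^ (2 + e)) X ⟩
    rodriguesCoeff n j * X * p ^ (2 + e)             ≡⟨ cong (_* p ^ (2 + e)) (rodriguesCoeff-ratio j e) ⟩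
    rodriguesCoeff n (suc j) * R * (p * (p * p ^ e)) ≡⟨ regroup (rodriguesCoeff n (suc j)) R p (p ^ e) ⟩
    R * (p * p * (rodriguesCoeff n (suc j) * p ^ e)) ≡⟨ cong (λ k → R * (p * p * (rodriguesCoeff n (suc j) * p ^ k))) n∸2j′≡e ⟨
    R * (p * p * rodriguesMagnitude p n (suc j))     ∎)
    where
    open ≡-Reasoning
    n = suc (j + suc (j + e))
    X = (2 + e) * (1 + e)
    R = (suc j + suc j) * (3 + (j + e) + (j + e))
    n∸2j≡2+e : n ∸ (j + j) ≡ 2 + e
    n∸2j≡2+e = trans (cong (_∸ (j + j)) (split₁ j e)) (m+n∸m≡n (j + j) (2 + e))
      where split₁ : ∀ j e → suc (j + suc (j + e)) ≡ j + j + (2 + e)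
            split₁ = solve-∀
    n∸2j′≡e : n ∸ (suc j + suc j) ≡ e
    n∸2j′≡e = trans (cong (_∸ (suc j + suc j)) (split₂ j e)) (m+n∸m≡n (suc j + suc j) e)
      where split₂ : ∀ j e → suc (j + suc (j + e)) ≡ suc j + suc j + e
            split₂ = solve-∀
    swap : ∀ c P X → c * P * X ≡ c * X * P
    swap = solve-∀
    regroup : ∀ c R p P → c * R * (p * (p * P)) ≡ R * (p * p * (c * P))
    regroup = solve-∀

  magnitude-telescope : ∀ p {n K r} → n ≡ K + K + r → ∀ d j → j + d ≡ K →
    p ^ (d + d) * rodriguesMagnitude p n K ∣ rodriguesMagnitude p n j * (d + d + r) !
  magnitude-telescope p {n} {K} {r} n≡2K+r zero j j+0≡K =
    subst (λ i → 1 * rodriguesMagnitude p n K ∣ rodriguesMagnitude p n i * r !) (trans (sym j+0≡K) (+-identityʳ j))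
      (subst (_∣ rodriguesMagnitude p n K * r !) (sym (*-identityˡ _)) (m∣m*n (r !)))
  magnitude-telescope p {n} {K} {r} n≡2K+r (suc d) j j+1+d≡K = begin
    p ^ (suc d + suc d) * M K       ≡⟨ cong (_* M K) (p^[2+2d] p d) ⟩
    p * p * p ^ (d + d) * M K       ≡⟨ *-assoc (p * p) (p ^ (d + d)) (M K) ⟩
    p * p * (p ^ (d + d) * M K)     ∣⟨ *-monoʳ-∣ (p * p) (magnitude-telescope p n≡2K+r d (suc j) (trans (sym (+-suc j d)) j+1+d≡K)) ⟩
    p * p * (M (suc j) * e !)       ≡⟨ *-assoc (p * p) (M (suc j)) (e !) ⟨
    p * p * M (suc j) * e !         ∣⟨ *-monoˡ-∣ (e !) step ⟩
    M j * ((2 + e) * (1 + e)) * e ! ≡⟨ regroup (M j) (2 + e) (1 + e) (e !) ⟩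
    M j * (2 + e) !                 ≡⟨ cong (λ k → M j * k !) (2+e≡ d r) ⟩
    M j * (suc d + suc d + r) !     ∎
    where
    open ∣-Reasoning
    M = rodriguesMagnitude p n
    e = d + d + r
    step : p * p * M (suc j) ∣ M j * ((2 + e) * (1 + e))
    step = subst (λ n → p * p * rodriguesMagnitude p n (suc j) ∣ rodriguesMagnitude p n j * ((2 + e) * (1 + e)))
                 (sym n≡) (magnitude-step p j e)
      where
      shape : ∀ j d r → j + suc d + (j + suc d) + r ≡ suc (j + suc (j + (d + d + r)))
      shape = solve-∀
      n≡ = trans n≡2K+r (trans (cong (λ k → k + k + r) (sym j+1+d≡K)) (shape j d r))
    p^[2+2d] : ∀ p d → p ^ (suc d + suc d) ≡ p * p * p ^ (d + d)
    p^[2+2d] p d = trans (cong (λ k → p ^ suc k) (+-suc d d)) (sym (*-assoc p p (p ^ (d + d))))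
    regroup : ∀ a b c x → a * (b * c) * x ≡ a * (b * (c * x))
    regroup = solve-∀
    2+e≡ : ∀ d r → 2 + (d + d + r) ≡ suc d + suc d + r
    2+e≡ = solve-∀

  ν-factorial-bound : ∀ {p} → Prime p → 2 < p → ∀ d r → r ≤ 1 → ν p ((d + d + r) !) ≤ d
  ν-factorial-bound {p@(suc p-1)} p-prime (s≤s 2≤p-1) d r r≤1 with ν p ((d + d + r) !) ≤? d
  ... | yes v≤d = v≤d
  ... | no  v≰d = ⊥-elim (<-irrefl refl (begin-strict
    d + d + 1           ≡⟨ +-comm (d + d) 1 ⟩
    suc (d + d)         <⟨ n<1+n (suc (d + d)) ⟩
    suc (suc (d + d))   ≡⟨ cong suc (+-suc d d) ⟨
    suc d + suc d       ≤⟨ +-mono-≤ (≰⇒> v≰d) (≰⇒> v≰d) ⟩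
    v + v               ≡⟨ cong (v +_) (+-identityʳ v) ⟨
    2 * v               ≤⟨ *-monoˡ-≤ v 2≤p-1 ⟩
    (p ∸ 1) * v         ≤⟨ m≤m+n ((p ∸ 1) * v) (s p N) ⟩
    (p ∸ 1) * v + s p N ≡⟨ legendre-formula p-prime N ⟩
    d + d + r           ≤⟨ +-monoʳ-≤ (d + d) r≤1 ⟩
    d + d + 1           ∎))
    where
    open ≤-Reasoning
    N = d + d + r
    v = ν p (N !)

  magnitude-dominated : ∀ {p} → Prime p → 2 < p → ∀ {n K r} → n ≡ K + K + r → r ≤ 1 → ∀ {j} → j < K →
    p ^ suc (ν p (rodriguesMagnitude p n K)) ∣ rodriguesMagnitude p n j
  magnitude-dominated {p} p-prime 2<p {n} {K} {r} n≡2K+r r≤1 {j} j<K with m≤n⇒∃[o]m+o≡n j<K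
  ... | o , 1+j+o≡K = ∣-trans (pow-mono-∣ p νK<νj) (p^ν∣ 1<p (magnitude-pos 0<p n j 2j≤n))
    where
    1<p = <-trans (n<1+n 1) 2<p
    0<p = <-trans z<s 1<p
    d = suc o
    N = d + d + r
    M = rodriguesMagnitude p n
    j+d≡K = trans (+-suc j o) 1+j+o≡K
    2K≤n : K + K ≤ n
    2K≤n = subst (K + K ≤_) (sym n≡2K+r) (m≤m+n (K + K) r)
    2j≤n : j + j ≤ n
    2j≤n = ≤-trans (+-mono-≤ (<⇒≤ j<K) (<⇒≤ j<K)) 2K≤n
    p^[2d+νK]∣Mj*N! : p ^ (d + d + ν p (M K)) ∣ M j * N !
    p^[2d+νK]∣Mj*N! = ∣-trans (subst (_∣ p ^ (d + d) * M K) (sym (^-distribˡ-+-* p (d + d) (ν p (M K))))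
                                       (*-monoʳ-∣ (p ^ (d + d)) (p^ν∣ 1<p (magnitude-pos 0<p n K 2K≤n))))
                              (magnitude-telescope p n≡2K+r d j j+d≡K)
    νK<νj : suc (ν p (M K)) ≤ ν p (M j)
    νK<νj = +-cancelˡ-≤ d _ _ (begin
      d + suc (ν p (M K))   ≤⟨ +-monoʳ-≤ d (+-monoˡ-≤ (ν p (M K)) (s≤s z≤n)) ⟩
      d + (d + ν p (M K))   ≡⟨ +-assoc d d (ν p (M K)) ⟨
      d + d + ν p (M K)     ≤⟨ pow∣⇒≤ν 1<p (*-pos (magnitude-pos 0<p n j 2j≤n) (1≤n! N)) p^[2d+νK]∣Mj*N! ⟩
      ν p (M j * N !)       ≡⟨ ν-* 1<p p-prime (magnitude-pos 0<p n j 2j≤n) (1≤n! N) ⟩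
      ν p (M j) + ν p (N !) ≤⟨ +-monoʳ-≤ (ν p (M j)) (ν-factorial-bound p-prime 2<p d r r≤1) ⟩
      ν p (M j) + d         ≡⟨ +-comm (ν p (M j)) d ⟩
      d + ν p (M j)         ∎)
      where open ≤-Reasoning

module LegendreValuation where

  open import Data.Nat as ℕ using (zero; suc; _∸_; _<_; _≤_; s≤s; z<s)
  open import Data.Nat.Properties as ℕₚ using (≤-trans; +-mono-≤; +-monoʳ-≤; m≤m+n; +-suc; +-comm; m^n>0)
  import Data.Nat.Divisibility as ℕᵈ
  open import Data.Nat.DivMod using (m*n/n≡m; m≡m%n+[m/n]*n; m%n<n)
  open import Data.Nat.Primality using (Prime; euclidsLemma; prime⇒irreducible)
  import Data.Nat.Tactic.RingSolver as ℕ-Solver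
  open import Data.Integer using (+_; 1ℤ; -1ℤ; _+_; _*_; _^_)
  open import Data.Integer.Properties using (pos-*; *-assoc; *-identityˡ)
  open import Data.Integer.Divisibility.Signed using (_∣_; ∣ᵤ⇒∣; ∣⇒∣ᵤ; ∣n⇒∣m*n)
  import Data.Integer.Tactic.RingSolver as ℤ-Solver
  open import Data.Empty using (⊥-elim)
  open import Data.Product using (proj₁; proj₂)
  open import Data.Sum using (inj₁; inj₂)
  open import Relation.Nullary using (¬_)
  open import Relation.Binary.PropositionalEquality
  open import Defs using (ν; sumTo; legendreAtOdd)
  open IntegerSums
  open LegendreCoefficients using (legendreCoeff)
  open RodriguesCoefficients using (rodriguesCoeff)
  open LegendreExpansion using (legendreSum; legendre-expansion; rodriguesTerm; rodriguesSum; rodriguesTerm-vanish)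
  open Valuation using (*-pos; p^ν∣; p^1+ν∤; ν-unique; ν-coprime; ν-*)
  open DominantTerm

  pos-^ : ∀ a k → + (a ℕ.^ k) ≡ (+ a) ^ k
  pos-^ a zero    = refl
  pos-^ a (suc k) = trans (pos-* a (a ℕ.^ k)) (cong (+ a *_) (pos-^ a k))

  -1^k*-1^k : ∀ k → -1ℤ ^ k * -1ℤ ^ k ≡ 1ℤ
  -1^k*-1^k zero    = refl
  -1^k*-1^k (suc k) = trans (square-neg (-1ℤ ^ k)) (-1^k*-1^k k)
    where square-neg : ∀ s → -1ℤ * s * (-1ℤ * s) ≡ s * s
          square-neg = ℤ-Solver.solve-∀

  rodriguesTerm-magnitude : ∀ p n j → rodriguesTerm (+ p) n j ≡ -1ℤ ^ j * + rodriguesMagnitude p n j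
  rodriguesTerm-magnitude p n j = begin
    -1ℤ ^ j * + c * (+ p) ^ e   ≡⟨ *-assoc (-1ℤ ^ j) (+ c) ((+ p) ^ e) ⟩
    -1ℤ ^ j * (+ c * (+ p) ^ e) ≡⟨ cong (-1ℤ ^ j *_) (trans (pos-* c (p ℕ.^ e)) (cong (+ c *_) (pos-^ p e))) ⟨
    -1ℤ ^ j * + (c ℕ.* p ℕ.^ e) ∎
    where
    open ≡-Reasoning
    c = rodriguesCoeff n j
    e = n ∸ (j ℕ.+ j)

  ν-rodriguesSum : ∀ {p} → Prime p → 2 < p → ∀ {n K r N} → n ≡ K ℕ.+ K ℕ.+ r → r ≤ 1 →
    0 < N → + N ≡ rodriguesSum (+ p) n → ν p N ≡ ν p (rodriguesMagnitude p n K)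
  ν-rodriguesSum {p} p-prime 2<p {n} {K} {r} {N} n≡2K+r r≤1 0<N N≡sum =
    ν-unique 1<p 0<N (∣⇒∣ᵤ (subst (+ P ∣_) (sym N≡sumK) (proj₁ exact)))
                     (λ pP∣N → proj₂ exact (subst (+ (p ℕ.* P) ∣_) N≡sumK (∣ᵤ⇒∣ pP∣N)))
    where
    1<p = ℕₚ.<-trans (ℕₚ.n<1+n 1) 2<p
    M = rodriguesMagnitude p n
    v = ν p (M K)
    P = p ℕ.^ v
    2K≤n : K ℕ.+ K ≤ n
    2K≤n = subst (K ℕ.+ K ≤_) (sym n≡2K+r) (m≤m+n (K ℕ.+ K) r)
    0<MK = magnitude-pos (ℕₚ.<-trans z<s 1<p) n K 2K≤n
    T = rodriguesTerm (+ p) n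
    sum≡ : rodriguesSum (+ p) n ≡ sumToℤ K T
    sum≡ = trans (cong (λ b → sumToℤ b T) (trans n≡2K+r (shape K r)))
                 (sumToℤ-extend K (K ℕ.+ r) T (λ k K<k → rodriguesTerm-vanish (+ p) n k (n<2k K<k)))
      where
      shape : ∀ K r → K ℕ.+ K ℕ.+ r ≡ K ℕ.+ r ℕ.+ K
      shape = ℕ-Solver.solve-∀
      n<2k : ∀ {k} → K < k → n < k ℕ.+ k
      n<2k {k} K<k = begin-strict
        n                   ≡⟨ n≡2K+r ⟩
        K ℕ.+ K ℕ.+ r       ≤⟨ +-monoʳ-≤ (K ℕ.+ K) r≤1 ⟩
        K ℕ.+ K ℕ.+ 1       ≡⟨ +-comm (K ℕ.+ K) 1 ⟩
        suc (K ℕ.+ K)       <⟨ ℕₚ.n<1+n (suc (K ℕ.+ K)) ⟩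
        suc (suc (K ℕ.+ K)) ≡⟨ cong suc (+-suc K K) ⟨
        suc K ℕ.+ suc K     ≤⟨ +-mono-≤ K<k K<k ⟩
        k ℕ.+ k             ∎
        where open ℕₚ.≤-Reasoning
    N≡sumK : + N ≡ sumToℤ K T
    N≡sumK = trans N≡sum sum≡
    magnitude∣T : ∀ {d} j → d ℕᵈ.∣ M j → + d ∣ T j
    magnitude∣T {d} j d∣Mj = subst (+ d ∣_) (sym (rodriguesTerm-magnitude p n j)) (∣n⇒∣m*n (-1ℤ ^ j) (∣ᵤ⇒∣ d∣Mj))
    T∣magnitude : ∀ {d} j → + d ∣ T j → d ℕᵈ.∣ M j
    T∣magnitude {d} j d∣Tj =
      ∣⇒∣ᵤ (subst (+ d ∣_) unsign (∣n⇒∣m*n (-1ℤ ^ j) (subst (+ d ∣_) (rodriguesTerm-magnitude p n j) d∣Tj)))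
      where
      unsign : -1ℤ ^ j * (-1ℤ ^ j * + M j) ≡ + M j
      unsign = trans (sym (*-assoc (-1ℤ ^ j) (-1ℤ ^ j) (+ M j))) (trans (cong (_* + M j) (-1^k*-1^k j)) (*-identityˡ (+ M j)))
    exact = sumToℤ-exactly-∣ K T (∣ᵤ⇒∣ (ℕᵈ.n∣m*n p))
      (λ j j<K → magnitude∣T j (magnitude-dominated p-prime 2<p n≡2K+r r≤1 j<K))
      (magnitude∣T K (p^ν∣ 1<p 0<MK)) (λ pP∣TK → p^1+ν∤ 1<p 0<MK (T∣magnitude K pP∣TK))

  private
    sumTo-first : ∀ n f → f 0 ≤ sumTo n f
    sumTo-first zero    f = ℕₚ.≤-refl
    sumTo-first (suc n) f = ≤-trans (sumTo-first n f) (m≤m+n (sumTo n f) (f (suc n)))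

    odd-half : ∀ {p} → Prime p → 2 < p → 1 ℕ.+ 2 ℕ.* ((p ∸ 1) ℕ./ 2) ≡ p
    odd-half {p} p-prime 2<p = begin
      1 ℕ.+ 2 ℕ.* ((p ∸ 1) ℕ./ 2) ≡⟨ cong (λ x → 1 ℕ.+ 2 ℕ.* (x ℕ./ 2)) (cong (_∸ 1) p≡1+2h) ⟩
      1 ℕ.+ 2 ℕ.* (h ℕ.* 2 ℕ./ 2) ≡⟨ cong (λ x → 1 ℕ.+ 2 ℕ.* x) (m*n/n≡m h 2) ⟩
      1 ℕ.+ 2 ℕ.* h               ≡⟨ cong suc (ℕₚ.*-comm 2 h) ⟩
      1 ℕ.+ h ℕ.* 2               ≡⟨ p≡1+2h ⟨
      p                           ∎
      where
      open ≡-Reasoning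
      h = p ℕ./ 2
      2∤p : ¬ 2 ℕᵈ.∣ p
      2∤p 2∣p with prime⇒irreducible p-prime 2∣p
      ... | inj₂ refl = ℕₚ.<-irrefl refl 2<p
      p≡1+2h : p ≡ 1 ℕ.+ h ℕ.* 2
      p≡1+2h with p ℕ.% 2 in p%2≡r | m%n<n p 2
      ... | 0 | _ = ⊥-elim (2∤p (ℕᵈ.m%n≡0⇒n∣m p 2 p%2≡r))
      ... | 1 | _ = trans (m≡m%n+[m/n]*n p 2) (cong (ℕ._+ h ℕ.* 2) p%2≡r)
      ... | suc (suc _) | s≤s (s≤s ())

    p∤2^n : ∀ {p} → Prime p → 2 < p → ∀ n → ¬ p ℕᵈ.∣ 2 ℕ.^ n
    p∤2^n {p} p-prime 2<p zero p∣1 = ℕₚ.<⇒≢ (ℕₚ.<-trans (ℕₚ.n<1+n 1) 2<p) (sym (ℕᵈ.∣1⇒≡1 p∣1))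
    p∤2^n {p} p-prime 2<p (suc n) p∣2^[1+n] with euclidsLemma 2 (2 ℕ.^ n) p-prime p∣2^[1+n]
    ... | inj₁ p∣2 = ℕₚ.<⇒≱ 2<p (ℕᵈ.∣⇒≤ p∣2)
    ... | inj₂ p∣2^n = p∤2^n p-prime 2<p n p∣2^n

  ν-legendreAtOdd : ∀ {p} → Prime p → 2 < p → ∀ {n K r} → n ≡ K ℕ.+ K ℕ.+ r → r ≤ 1 →
    ν p (legendreAtOdd n p) ≡ ν p (rodriguesMagnitude p n K)
  ν-legendreAtOdd {p} p-prime 2<p {n} {K} n≡2K+r r≤1 = begin
    ν p L                          ≡⟨ cong (ℕ._+ ν p L) (ν-coprime 1<p (p∤2^n p-prime 2<p n)) ⟨
    ν p (2 ℕ.^ n) ℕ.+ ν p L        ≡⟨ ν-* 1<p p-prime (m^n>0 2 n) 0<L ⟨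
    ν p (2 ℕ.^ n ℕ.* L)            ≡⟨ ν-rodriguesSum p-prime 2<p {K = K} n≡2K+r r≤1 (*-pos (m^n>0 2 n) 0<L) expansion ⟩
    ν p (rodriguesMagnitude p n K) ∎
    where
    open ≡-Reasoning
    1<p = ℕₚ.<-trans (ℕₚ.n<1+n 1) 2<p
    q = (p ∸ 1) ℕ./ 2
    L = legendreAtOdd n p
    0<L : 0 < L
    0<L = sumTo-first n _
    legendreAtOdd≡legendreSum : + L ≡ legendreSum (+ q) n
    legendreAtOdd≡legendreSum = trans (pos-sumTo n _) (sumToℤ-cong n λ k →
      trans (pos-* (legendreCoeff n k) (q ℕ.^ k)) (cong (+ legendreCoeff n k *_) (pos-^ q k)))
    1+2q≡p : 1ℤ + + 2 * + q ≡ + p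
    1+2q≡p = trans (cong (_+_ 1ℤ) (sym (pos-* 2 q))) (cong +_ (odd-half p-prime 2<p))
    expansion : + (2 ℕ.^ n ℕ.* L) ≡ rodriguesSum (+ p) n
    expansion = begin
      + (2 ℕ.^ n ℕ.* L)               ≡⟨ trans (pos-* (2 ℕ.^ n) L) (cong (_* + L) (pos-^ 2 n)) ⟩
      (+ 2) ^ n * + L                 ≡⟨ cong ((+ 2) ^ n *_) legendreAtOdd≡legendreSum ⟩
      (+ 2) ^ n * legendreSum (+ q) n ≡⟨ legendre-expansion (+ q) n ⟩
      rodriguesSum (1ℤ + + 2 * + q) n ≡⟨ cong (λ y → rodriguesSum y n) 1+2q≡p ⟩
      rodriguesSum (+ p) n            ∎

module CentralTerm where

  open import Data.Nat
  open import Data.Nat.Properties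
  open import Data.Nat.Divisibility using (∣1⇒≡1; ∣⇒≤)
  open import Data.Nat.DivMod using (m≡m%n+[m/n]*n; m%n<n)
  open import Data.Nat.Combinatorics using (_C_)
  open import Data.Nat.Primality using (Prime; prime⇒nonTrivial)
  open import Data.Nat.Tactic.RingSolver using (solve-∀)
  open import Relation.Binary.PropositionalEquality
  open import Defs using (ν; s; legendreAtOdd)
  open Binomial using (C-factorial; C-pos)
  open RodriguesCoefficients using (rodriguesCoeff; rodriguesCoeff-central; rodriguesCoeff-central-odd)
  open Valuation using (*-pos; ν-coprime; ν-*; ν-p*)
  open LegendreFormula using (legendre-formula)
  open DominantTerm using (rodriguesMagnitude)
  open LegendreValuation using (ν-legendreAtOdd)

  ν-legendreAtOdd-even : ∀ {p} → Prime p → 2 < p → ∀ m → ν p (legendreAtOdd (m + m) p) ≡ ν p ((m + m) C m)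
  ν-legendreAtOdd-even {p} p-prime 2<p m = begin
    ν p (legendreAtOdd (m + m) p)        ≡⟨ ν-legendreAtOdd p-prime 2<p {K = m} (sym (+-identityʳ (m + m))) z≤n ⟩
    ν p (rodriguesMagnitude p (m + m) m) ≡⟨ cong (λ e → ν p (rodriguesCoeff (m + m) m * p ^ e)) (n∸n≡0 (m + m)) ⟩
    ν p (rodriguesCoeff (m + m) m * 1)   ≡⟨ cong (ν p) (trans (*-identityʳ _) (rodriguesCoeff-central m)) ⟩
    ν p ((m + m) C m)                    ∎
    where open ≡-Reasoning

  ν-legendreAtOdd-odd : ∀ {p} → Prime p → 2 < p → ∀ m →
    ν p (legendreAtOdd (suc (m + m)) p) ≡ 1 + ν p (suc (m + m)) + ν p ((m + m) C m)
  ν-legendreAtOdd-odd {p} p-prime 2<p m = begin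
    ν p (legendreAtOdd (suc (m + m)) p)            ≡⟨ ν-legendreAtOdd p-prime 2<p {K = m} (+-comm 1 (m + m)) ≤-refl ⟩
    ν p (rodriguesMagnitude p (suc (m + m)) m)     ≡⟨ cong (λ e → ν p (rodriguesCoeff (suc (m + m)) m * p ^ e)) (m+n∸n≡m 1 (m + m)) ⟩
    ν p (rodriguesCoeff (suc (m + m)) m * (p * 1)) ≡⟨ cong (λ c → ν p (c * (p * 1))) (rodriguesCoeff-central-odd m) ⟩
    ν p (2 * (N * B) * (p * 1))                    ≡⟨ ν-* 1<p p-prime 0<2NB 0<p*1 ⟩
    ν p (2 * (N * B)) + ν p (p * 1)                ≡⟨ cong₂ _+_ ν[2NB] ν[p] ⟩
    0 + (ν p N + ν p B) + 1                        ≡⟨ +-comm (ν p N + ν p B) 1 ⟩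
    1 + (ν p N + ν p B)                            ≡⟨ +-assoc 1 (ν p N) (ν p B) ⟨
    1 + ν p N + ν p B                              ∎
    where
    open ≡-Reasoning
    1<p = <-trans (n<1+n 1) 2<p
    N = suc (m + m)
    B = (m + m) C m
    0<B : 0 < B
    0<B = C-pos (m≤m+n m m)
    0<NB : 0 < N * B
    0<NB = *-pos {N} {B} z<s 0<B
    0<2NB : 0 < 2 * (N * B)
    0<2NB = *-pos {2} {N * B} z<s 0<NB
    0<p*1 : 0 < p * 1
    0<p*1 = *-pos {p} {1} (<-trans z<s 1<p) z<s
    ν[2NB] : ν p (2 * (N * B)) ≡ 0 + (ν p N + ν p B)
    ν[2NB] = trans (ν-* 1<p p-prime z<s 0<NB) (cong₂ _+_ (ν-coprime 1<p (λ p∣2 → <⇒≱ 2<p (∣⇒≤ p∣2))) (ν-* 1<p p-prime z<s 0<B))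
    ν[p] : ν p (p * 1) ≡ 1
    ν[p] = trans (ν-p* 1<p z<s) (cong suc (ν-coprime 1<p (λ p∣1 → <⇒≢ 1<p (sym (∣1⇒≡1 p∣1)))))

  private
    ν-central-factorial : ∀ {p} → Prime p → ∀ m → ν p ((m + m) !) ≡ ν p ((m + m) C m) + (ν p (m !) + ν p (m !))
    ν-central-factorial {p} p-prime m = begin
      ν p ((m + m) !)                             ≡⟨ cong (ν p) (C-factorial m m) ⟨
      ν p (((m + m) C m) * (m ! * m !))           ≡⟨ ν-* 1<p p-prime (C-pos (m≤m+n m m)) (*-pos {m !} {m !} (1≤n! m) (1≤n! m)) ⟩
      ν p ((m + m) C m) + ν p (m ! * m !)         ≡⟨ cong (ν p ((m + m) C m) +_) (ν-* 1<p p-prime (1≤n! m) (1≤n! m)) ⟩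
      ν p ((m + m) C m) + (ν p (m !) + ν p (m !)) ∎
      where
      open ≡-Reasoning
      1<p = nonTrivial⇒n>1 p {{prime⇒nonTrivial p-prime}}

  digit-formula-even : ∀ {p} → Prime p → 2 < p → ∀ m →
    (p ∸ 1) * ν p (legendreAtOdd (m + m) p) + s p (m + m) ≡ 2 * s p m
  digit-formula-even {p} p-prime 2<p m = +-cancelʳ-≡ X _ _ (begin
    c * ν p (legendreAtOdd (m + m) p) + s p (m + m) + X ≡⟨ cong (λ v → c * v + s p (m + m) + X) (ν-legendreAtOdd-even p-prime 2<p m) ⟩
    c * ν p B + s p (m + m) + X                         ≡⟨ collect c (ν p B) (ν p (m !)) (s p (m + m)) ⟩
    c * (ν p B + (ν p (m !) + ν p (m !))) + s p (m + m) ≡⟨ cong (λ v → c * v + s p (m + m)) (ν-central-factorial p-prime m) ⟨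
    c * ν p ((m + m) !) + s p (m + m)                   ≡⟨ legendre-formula p-prime (m + m) ⟩
    m + m                                               ≡⟨ cong₂ _+_ (legendre-formula p-prime m) (legendre-formula p-prime m) ⟨
    (c * ν p (m !) + s p m) + (c * ν p (m !) + s p m)   ≡⟨ separate (c * ν p (m !)) (s p m) ⟩
    2 * s p m + X                                       ∎)
    where
    open ≡-Reasoning
    c = p ∸ 1
    B = (m + m) C m
    X = c * ν p (m !) + c * ν p (m !)
    collect : ∀ c b f d → c * b + d + (c * f + c * f) ≡ c * (b + (f + f)) + d
    collect = solve-∀
    separate : ∀ x d → (x + d) + (x + d) ≡ 2 * d + (x + x)
    separate = solve-∀

  digit-formula-odd : ∀ {p} → Prime p → 2 < p → ∀ m →
    (p ∸ 1) * ν p (legendreAtOdd (suc (m + m)) p) + s p (suc (m + m)) ≡ 2 * s p m + p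
  digit-formula-odd {p} p-prime 2<p m = +-cancelʳ-≡ X _ _ (begin
    c * ν p (legendreAtOdd N p) + s p N + X ≡⟨ cong (λ v → c * v + s p N + X) (ν-legendreAtOdd-odd p-prime 2<p m) ⟩
    c * (1 + ν p N + ν p B) + s p N + X     ≡⟨ collect c (ν p N) (ν p B) (ν p (m !)) (s p N) ⟩
    c + (c * (ν p N + (ν p B + (ν p (m !) + ν p (m !)))) + s p N)
      ≡⟨ cong (λ v → c + (c * (ν p N + v) + s p N)) (ν-central-factorial p-prime m) ⟨
    c + (c * (ν p N + ν p ((m + m) !)) + s p N)             ≡⟨ cong (λ v → c + (c * v + s p N)) (ν-* 1<p p-prime z<s (1≤n! (m + m))) ⟨
    c + (c * ν p (N !) + s p N)                             ≡⟨ cong (c +_) (legendre-formula p-prime N) ⟩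
    c + N                                                   ≡⟨ +-suc c (m + m) ⟩
    suc c + (m + m)                                         ≡⟨ cong₂ _+_ 1+c≡p (sym (cong₂ _+_ (legendre-formula p-prime m) (legendre-formula p-prime m))) ⟩
    p + ((c * ν p (m !) + s p m) + (c * ν p (m !) + s p m)) ≡⟨ separate p (c * ν p (m !)) (s p m) ⟩
    2 * s p m + p + X                                       ∎)
    where
    open ≡-Reasoning
    1<p = <-trans (n<1+n 1) 2<p
    c = p ∸ 1
    N = suc (m + m)
    B = (m + m) C m
    X = c * ν p (m !) + c * ν p (m !)
    1+c≡p : suc c ≡ p
    1+c≡p = trans (+-comm 1 c) (m∸n+n≡m (<⇒≤ 1<p))
    collect : ∀ c a b f d → c * (1 + a + b) + d + (c * f + c * f) ≡ c + (c * (a + (b + (f + f))) + d)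
    collect = solve-∀
    separate : ∀ p x d → p + ((x + d) + (x + d)) ≡ 2 * d + p + (x + x)
    separate = solve-∀

  digit-formula : ∀ {p} → Prime p → 2 < p → ∀ n →
    (p ∸ 1) * ν p (legendreAtOdd n p) + s p n ≡ 2 * s p (n / 2) + (n % 2) * p
  digit-formula {p} p-prime 2<p n =
    subst (λ k → (p ∸ 1) * ν p (legendreAtOdd k p) + s p k ≡ 2 * s p (n / 2) + (n % 2) * p)
          (sym (m≡m%n+[m/n]*n n 2)) (by-parity (n % 2) (n / 2) (m%n<n n 2))
    where
    twice : ∀ m → m * 2 ≡ m + m
    twice m = trans (*-comm m 2) (cong (m +_) (+-identityʳ m))
    by-parity : ∀ r m → r < 2 →
      (p ∸ 1) * ν p (legendreAtOdd (r + m * 2) p) + s p (r + m * 2) ≡ 2 * s p m + r * p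
    by-parity 0 m _ =
      subst (λ k → (p ∸ 1) * ν p (legendreAtOdd k p) + s p k ≡ 2 * s p m + 0)
            (sym (twice m)) (trans (digit-formula-even p-prime 2<p m) (sym (+-identityʳ _)))
    by-parity 1 m _ =
      subst (λ k → (p ∸ 1) * ν p (legendreAtOdd (suc k) p) + s p (suc k) ≡ 2 * s p m + 1 * p)
            (sym (twice m)) (trans (digit-formula-odd p-prime 2<p m) (cong (2 * s p m +_) (sym (*-identityˡ p))))
    by-parity (suc (suc _)) _ (s≤s (s≤s ()))

open import Defs
open import Data.Nat using (ℕ; suc; _+_; _*_; _∸_; _/_; _%_; _≤_)
open import Data.Nat.Primality using (Prime)
open import Data.Nat.Combinatorics using (_C_)
open import Data.Product using (_×_; _,_)
open import Relation.Binary.PropositionalEquality using (_≡_; cong; subst; sym)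
open import Data.Nat.Properties using (+-identityʳ)
open CentralTerm using (ν-legendreAtOdd-even; ν-legendreAtOdd-odd; digit-formula)

theorem4 : (p : ℕ) → Prime p → 3 ≤ p →
    ((m : ℕ) →
      (ν p (legendreAtOdd (2 * m) p) ≡ ν p ((2 * m) C m))
      × (ν p (legendreAtOdd (suc (2 * m)) p) ≡ 1 + ν p (suc (2 * m)) + ν p ((2 * m) C m)))
    × ((n : ℕ) →
      (p ∸ 1) * ν p (legendreAtOdd n p) + s p n ≡ 2 * s p (n / 2) + (n % 2) * p)
theorem4 p p-prime 2<p = (λ m → even m , odd m) , digit-formula p-prime 2<p
  where
  m+m≡2m : ∀ m → m + m ≡ 2 * m
  m+m≡2m m = cong (m +_) (sym (+-identityʳ m))
  even : ∀ m → ν p (legendreAtOdd (2 * m) p) ≡ ν p ((2 * m) C m)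
  even m = subst (λ n → ν p (legendreAtOdd n p) ≡ ν p (n C m)) (m+m≡2m m) (ν-legendreAtOdd-even p-prime 2<p m)
  odd : ∀ m → ν p (legendreAtOdd (suc (2 * m)) p) ≡ 1 + ν p (suc (2 * m)) + ν p ((2 * m) C m)
  odd m = subst (λ n → ν p (legendreAtOdd (suc n) p) ≡ 1 + ν p (suc n) + ν p (n C m)) (m+m≡2m m) (ν-legendreAtOdd-odd p-prime 2<p m)
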